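{- Let $G=(V,E)$ be a trivalent $2$-edge-connected graph and let $B$ be a basis of the graph curve matroid $M_G$. Then $\omega(V- B)=\omega(B)$.
   Context: Graphs are finite and undirected and may have parallel edges; trivalent means every vertex has degree $3$. $\omega(A)$ is the number of connected components of the induced subgraph $G[A]$, with $\omega(\emptyset)=0$. $r^*$ is the rank function of the bond (cographic) matroid of $G$. For $A\subseteq V$, $\delta(A)$ is the set of edges incident to at least one vertex of $A$. The graph curve matroid $M_G$ is the matroid on $V$ whose circuits are the non-empty subsets $A\subseteq V$ that are inclusion-minimal among non-empty subsets satisfying $r^*(\delta(A))\le|A|$. -}

module Defs where

open import Data.Nat using (ℕ; zero; suc; _+_; _∸_; _≤_)
open import Data.Bool using (Bool; true; false; _∧_; _∨_; not; if_then_else_)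
open import Data.Fin using (Fin; _≟_; _<?_)
open import Data.Fin.Subset using (Subset; ⊤; ∁; ∣_∣; _⊆_; Nonempty; _-_)
open import Data.Vec using (lookup; tabulate)
open import Data.List using (List; length; filterᵇ; map; allFin)
open import Data.Nat.ListAction using (sum)
open import Data.Bool.ListAction using (any)
open import Data.Product using (_×_; proj₁; proj₂)
open import Relation.Nullary using (¬_; ⌊_⌋)
open import Relation.Binary.PropositionalEquality using (_≡_)

record Graph : Set where
  field
    n    : ℕ
    m    : ℕ
    ends : Fin m → Fin n × Fin n

module _ (G : Graph) where
  open Graph G

  src tgt : Fin m → Fin n
  src e = proj₁ (ends e)
  tgt e = proj₂ (ends e)

  -- degree: number of edge-ends at v (a loop counts twice)
  degree : Fin n → ℕ
  degree v = sum (map (λ e → (if ⌊ src e ≟ v ⌋ then 1 else 0) + (if ⌊ tgt e ≟ v ⌋ then 1 else 0)) (allFin m))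

  Trivalent : Set
  Trivalent = ∀ v → degree v ≡ 3

  -- reach k S Y u v : v is reachable from u by a walk of length ≤ k in the
  -- subgraph with vertex set S and edges those of Y with both ends in S
  reach : ℕ → Subset n → Subset m → Fin n → Fin n → Bool
  reach zero    S Y u v = ⌊ u ≟ v ⌋ ∧ lookup S v
  reach (suc k) S Y u v = reach k S Y u v ∨
    any (λ e → lookup Y e ∧ lookup S v ∧
               ((⌊ tgt e ≟ v ⌋ ∧ reach k S Y u (src e)) ∨ (⌊ src e ≟ v ⌋ ∧ reach k S Y u (tgt e))))
        (allFin m)

  -- connectivity in the subgraph (S , Y ∩ E(S)); walks of length < n suffice
  conn : Subset n → Subset m → Fin n → Fin n → Bool
  conn S Y = reach n S Y

  -- number of connected components of the subgraph with vertex set S and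
  -- edge set {e ∈ Y | both ends in S}: count the vertices of S that are the
  -- least-indexed vertex of their component
  comps : Subset n → Subset m → ℕ
  comps S Y = length (filterᵇ (λ v → lookup S v ∧ not (any (λ u → ⌊ u <? v ⌋ ∧ conn S Y u v) (allFin n))) (allFin n))

  -- ω(A): number of components of the induced subgraph G[A] (ω(∅) = 0)
  ω : Subset n → ℕ
  ω A = comps A ⊤

  c : Subset m → ℕ
  c Y = comps ⊤ Y

  rank : Subset m → ℕ
  rank Y = n ∸ c Y

  -- rank of the bond (cographic) matroid = dual of the cycle matroid:
  -- r*(X) = |X| + r(E - X) - r(E)
  rank* : Subset m → ℕ
  rank* X = ∣ X ∣ + rank (∁ X) ∸ rank ⊤

  δ : Subset n → Subset m
  δ A = tabulate (λ e → lookup A (src e) ∨ lookup A (tgt e))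

  Connected : Set
  Connected = c ⊤ ≡ 1

  TwoEdgeConnected : Set
  TwoEdgeConnected = Connected × (∀ e → c (⊤ - e) ≡ 1)

  Dep : Subset n → Set
  Dep A = Nonempty A × (rank* (δ A) ≤ ∣ A ∣)

  Circuit : Subset n → Set
  Circuit A = Dep A × (∀ A' → A' ⊆ A → Dep A' → A ⊆ A')

  Independent : Subset n → Set
  Independent I = ∀ C → C ⊆ I → ¬ Circuit C

  Basis : Subset n → Set
  Basis B = Independent B × (∀ I → B ⊆ I → Independent I → I ⊆ B)

module Submission where

-- Write r(A) = r*(δ(A)) and e(A) for the number of edges with both ends in A. In a connected graph
-- r*(X) = |X| + 1 - c(E - X), and the components of G - δ(A) are the vertices of A, isolated, together
-- with the components of G[V - A]; counting edge ends in a trivalent graph then gives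
--   r(A) + ω(V - A) + e(A) = 2|A| + 1.
-- M_G is the matroid induced by the monotone submodular function r - 1. In a 2-edge-connected graph every
-- component of G[V - Y] sends two edges to Y, whence 2r(Y) ≥ |Y| + 2 for Y ≠ ∅. For a basis B, a largest
-- P ⊆ B with r(P) = |P| + 1 therefore spans at most |P| vertices outside B, and every other vertex outside
-- B is spanned by B - P; peeling such sets off gives |V - B| ≤ |B|. With |B| + 1 ≤ r(B) ≤ r(V) and
-- 2r(V) = |V| + 2 this forces r(B) = |B| + 1, that is ω(V - B) + e(B) = |B|. Independence also gives
-- e(A) < |A| for every nonempty A ⊆ B, so G[B] is a forest and ω(B) + e(B) = |B|.

open import Defs
open import Data.Nat using (ℕ; zero; suc; _+_; _*_; _∸_; _≤_; _<_; z≤n; s≤s; _≤?_)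
open import Data.Nat.Properties hiding (_≟_; _<?_; <-cmp)
open import Data.Nat.ListAction using () renaming (sum to sumᴸ)
open import Data.Nat.Tactic.RingSolver using (solve-∀)
open import Data.Bool using (Bool; true; false; _∧_; _∨_; not; _xor_; if_then_else_)
import Data.Bool as Bool
open import Data.Bool.Properties using (T-≡)
open import Data.Bool.ListAction using (any; or)
import Data.Empty
open import Data.Fin using (Fin; zero; suc; toℕ; _≟_; _<?_)
import Data.Fin as Fin
open import Data.Fin.Induction using (<-wellFounded)
open import Data.Fin.Properties using (all?; any?; ¬∀⟶∃¬; <-cmp)
open import Data.Fin.Subset
open import Data.Fin.Subset.Properties
import Data.List as List
open import Data.List using (length; filterᵇ; allFin)
open import Data.List.Properties using (map-cong)
open import Data.List.Relation.Unary.Any.Properties using (any⁺; any⁻; tabulate⁺; tabulate⁻)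
open import Data.Product using (∃; ∃₂; _×_; _,_; proj₁; proj₂)
open import Data.Sum using (_⊎_; inj₁; inj₂; [_,_]′)
import Data.Sum
open import Data.Vec using ([]; _∷_; here; there; lookup; tabulate)
open import Data.Vec.Properties using (lookup∘tabulate; lookup-map; lookup-replicate; lookup⇒[]=; []=⇒lookup)
open import Function using (id; _∘_; Equivalence)
open import Induction.WellFounded using (Acc; acc)
open import Relation.Binary using (tri<; tri≈; tri>)
open import Relation.Binary.PropositionalEquality
open import Relation.Nullary using (¬_; Dec; ⌊_⌋; yes; no; contradiction; ¬?)
open import Relation.Nullary.Decidable using (_×-dec_; decidable-stable)
import Relation.Unary
open import Algebra.Properties.Semiring.Sum +-*-semiring
  using (sum-syntax; sum-cong-≗; ∑-distrib-+; ∑-comm; *-distribˡ-sum; *-distribʳ-sum; sum-replicate-zero)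
open import Algebra.Properties.CommutativeSemigroup +-commutativeSemigroup using (interchange; xy∙z≈xz∙y)
import Algebra.Lattice.Properties.BooleanAlgebra as BooleanAlgebraProperties

-- Finite subsets, counting and sums

module FiniteSets where

  private
    variable
      k : ℕ
      x : Fin k
      p q : Subset k

  true≢false : true ≢ false
  true≢false ()

  ∧-true : ∀ {a b} → a ∧ b ≡ true → a ≡ true × b ≡ true
  ∧-true {true} b≡true = refl , b≡true

  ∨-true : ∀ {a b} → a ∨ b ≡ true → a ≡ true ⊎ b ≡ true
  ∨-true {true}  _      = inj₁ refl
  ∨-true {false} b≡true = inj₂ b≡true

  ∨-trueʳ : ∀ {a b} → b ≡ true → a ∨ b ≡ true
  ∨-trueʳ {true}  _      = refl
  ∨-trueʳ {false} b≡true = b≡true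

  xor-true : ∀ {a b} → a xor b ≡ true → (a ≡ true × b ≡ false) ⊎ (a ≡ false × b ≡ true)
  xor-true {true}  {false} _ = inj₁ (refl , refl)
  xor-true {false} {true}  _ = inj₂ (refl , refl)

  xor-false : ∀ {a b} → a xor b ≡ false → a ≡ b
  xor-false {true}  {true}  _ = refl
  xor-false {false} {false} _ = refl

  ⌊⌋-true⁻ : ∀ {a} {A : Set a} (a? : Dec A) → ⌊ a? ⌋ ≡ true → A
  ⌊⌋-true⁻ (yes a) _ = a

  ⌊⌋-true⁺ : ∀ {a} {A : Set a} (a? : Dec A) → A → ⌊ a? ⌋ ≡ true
  ⌊⌋-true⁺ (yes _) _ = refl
  ⌊⌋-true⁺ (no ¬a) a = contradiction a ¬a

  ⌊suc≟suc⌋ : ∀ (i j : Fin k) → ⌊ suc i ≟ suc j ⌋ ≡ ⌊ i ≟ j ⌋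
  ⌊suc≟suc⌋ i j with i ≟ j
  ... | yes _ = refl
  ... | no  _ = refl

  any-allFin⁺ : ∀ {f : Fin k → Bool} i → f i ≡ true → any f (allFin k) ≡ true
  any-allFin⁺ {f = f} i fi = Equivalence.to T-≡ (any⁺ f (tabulate⁺ i (Equivalence.from T-≡ fi)))

  any-allFin⁻ : ∀ {f : Fin k → Bool} → any f (allFin k) ≡ true → ∃ λ i → f i ≡ true
  any-allFin⁻ {f = f} any≡true with tabulate⁻ (any⁻ f (allFin _) (Equivalence.from T-≡ any≡true))
  ... | i , Tfi = i , Equivalence.to T-≡ Tfi

  any-allFin-false : ∀ {f : Fin k → Bool} → (∀ i → f i ≡ true → Data.Empty.⊥) → any f (allFin k) ≡ false
  any-allFin-false {f = f} none with any f (allFin _) in any≡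
  ... | true  = let i , fi = any-allFin⁻ any≡ in Data.Empty.⊥-elim (none i fi)
  ... | false = refl

  length-filter-tabulate : ∀ {a} {A : Set a} (f : A → Bool) (g : Fin k → A) →
                           length (filterᵇ f (List.tabulate g)) ≡ ∣ tabulate (f ∘ g) ∣
  length-filter-tabulate {zero}  f g = refl
  length-filter-tabulate {suc k} f g with f (g zero)
  ... | true  = cong suc (length-filter-tabulate f (g ∘ suc))
  ... | false = length-filter-tabulate f (g ∘ suc)

  ∈-tabulate⁺ : ∀ {f : Fin k → Bool} → f x ≡ true → x ∈ tabulate f
  ∈-tabulate⁺ {x = x} {f} fx = lookup⇒[]= x (tabulate f) (trans (lookup∘tabulate f x) fx)

  ∈-tabulate⁻ : ∀ {f : Fin k → Bool} → x ∈ tabulate f → f x ≡ true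
  ∈-tabulate⁻ {x = x} {f} x∈ = trans (sym (lookup∘tabulate f x)) ([]=⇒lookup x∈)

  x∈p─q⇒x∉q : x ∈ p ─ q → x ∉ q
  x∈p─q⇒x∉q {p = _ ∷ _} {q = true ∷ _} () here
  x∈p─q⇒x∉q {p = _ ∷ _} {q = _ ∷ _} (there x∈) (there x∈q) = x∈p─q⇒x∉q x∈ x∈q

  p-x∪⁅x⁆≡p : x ∈ p → (p - x) ∪ ⁅ x ⁆ ≡ p
  p-x∪⁅x⁆≡p {x = x} {p = p} x∈p = ⊆-antisym ⊆p ⊇p
    where
    ⊆p : (p - x) ∪ ⁅ x ⁆ ⊆ p
    ⊆p y∈ with x∈p∪q⁻ (p - x) ⁅ x ⁆ y∈
    ... | inj₁ y∈p-x = p─q⊆p p ⁅ x ⁆ y∈p-x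
    ... | inj₂ y∈⁅x⁆ rewrite x∈⁅y⁆⇒x≡y x y∈⁅x⁆ = x∈p
    ⊇p : p ⊆ (p - x) ∪ ⁅ x ⁆
    ⊇p {y} y∈p with y ≟ x
    ... | yes refl = q⊆p∪q (p - x) ⁅ x ⁆ (x∈⁅x⁆ x)
    ... | no y≢x   = p⊆p∪q ⁅ x ⁆ (x∈p∧x≢y⇒x∈p-y y∈p y≢x)

  ∣p∪q∣+∣p∩q∣≡∣p∣+∣q∣ : ∀ (p q : Subset k) → ∣ p ∪ q ∣ + ∣ p ∩ q ∣ ≡ ∣ p ∣ + ∣ q ∣
  ∣p∪q∣+∣p∩q∣≡∣p∣+∣q∣ []          []          = refl
  ∣p∪q∣+∣p∩q∣≡∣p∣+∣q∣ (true ∷ p)  (true ∷ q)  =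
    cong suc (trans (+-suc _ _) (trans (cong suc (∣p∪q∣+∣p∩q∣≡∣p∣+∣q∣ p q)) (sym (+-suc _ _))))
  ∣p∪q∣+∣p∩q∣≡∣p∣+∣q∣ (true ∷ p)  (false ∷ q) = cong suc (∣p∪q∣+∣p∩q∣≡∣p∣+∣q∣ p q)
  ∣p∪q∣+∣p∩q∣≡∣p∣+∣q∣ (false ∷ p) (true ∷ q)  =
    trans (cong suc (∣p∪q∣+∣p∩q∣≡∣p∣+∣q∣ p q)) (sym (+-suc _ _))
  ∣p∪q∣+∣p∩q∣≡∣p∣+∣q∣ (false ∷ p) (false ∷ q) = ∣p∪q∣+∣p∩q∣≡∣p∣+∣q∣ p q

  ∣p∣≡∣p∩q∣+∣p─q∣ : ∀ (p q : Subset k) → ∣ p ∣ ≡ ∣ p ∩ q ∣ + ∣ p ─ q ∣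
  ∣p∣≡∣p∩q∣+∣p─q∣ []          []          = refl
  ∣p∣≡∣p∩q∣+∣p─q∣ (true ∷ p)  (true ∷ q)  = cong suc (∣p∣≡∣p∩q∣+∣p─q∣ p q)
  ∣p∣≡∣p∩q∣+∣p─q∣ (true ∷ p)  (false ∷ q) = trans (cong suc (∣p∣≡∣p∩q∣+∣p─q∣ p q)) (sym (+-suc _ _))
  ∣p∣≡∣p∩q∣+∣p─q∣ (false ∷ p) (true ∷ q)  = ∣p∣≡∣p∩q∣+∣p─q∣ p q
  ∣p∣≡∣p∩q∣+∣p─q∣ (false ∷ p) (false ∷ q) = ∣p∣≡∣p∩q∣+∣p─q∣ p q

  q⊆p⇒∣p∣≡∣q∣+∣p─q∣ : q ⊆ p → ∣ p ∣ ≡ ∣ q ∣ + ∣ p ─ q ∣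
  q⊆p⇒∣p∣≡∣q∣+∣p─q∣ {q = q} {p = p} q⊆p = trans (∣p∣≡∣p∩q∣+∣p─q∣ p q)
    (cong (λ r → ∣ r ∣ + ∣ p ─ q ∣) (⊆-antisym (p∩q⊆q p q) (λ y∈q → x∈p∩q⁺ (q⊆p y∈q , y∈q))))

  x∈p⇒∣p∣≡1+∣p-x∣ : x ∈ p → ∣ p ∣ ≡ suc ∣ p - x ∣
  x∈p⇒∣p∣≡1+∣p-x∣ {p = true ∷ p}  here        = cong (suc ∘ ∣_∣) (sym (p─⊥≡p p))
  x∈p⇒∣p∣≡1+∣p-x∣ {p = true ∷ p}  (there x∈p) = cong suc (x∈p⇒∣p∣≡1+∣p-x∣ x∈p)
  x∈p⇒∣p∣≡1+∣p-x∣ {p = false ∷ p} (there x∈p) = x∈p⇒∣p∣≡1+∣p-x∣ x∈p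

  x∉p⇒∣p∪⁅x⁆∣≡1+∣p∣ : x ∉ p → ∣ p ∪ ⁅ x ⁆ ∣ ≡ suc ∣ p ∣
  x∉p⇒∣p∪⁅x⁆∣≡1+∣p∣ {x = zero}  {p = true ∷ p}  x∉p = contradiction here x∉p
  x∉p⇒∣p∪⁅x⁆∣≡1+∣p∣ {x = zero}  {p = false ∷ p} x∉p = cong (suc ∘ ∣_∣) (∪-identityʳ p)
  x∉p⇒∣p∪⁅x⁆∣≡1+∣p∣ {x = suc x} {p = true ∷ p}  x∉p = cong suc (x∉p⇒∣p∪⁅x⁆∣≡1+∣p∣ (x∉p ∘ there))
  x∉p⇒∣p∪⁅x⁆∣≡1+∣p∣ {x = suc x} {p = false ∷ p} x∉p = x∉p⇒∣p∪⁅x⁆∣≡1+∣p∣ (x∉p ∘ there)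

  Empty⇒∣p∣≡0 : Empty p → ∣ p ∣ ≡ 0
  Empty⇒∣p∣≡0 {k} p≡∅ = trans (cong ∣_∣ (Empty-unique p≡∅)) (∣⊥∣≡0 k)

  Nonempty⇒∣p∣>0 : Nonempty p → 0 < ∣ p ∣
  Nonempty⇒∣p∣>0 (x , x∈p) = subst (0 <_) (sym (x∈p⇒∣p∣≡1+∣p-x∣ x∈p)) (s≤s z≤n)

  ∣p∣>0⇒Nonempty : 0 < ∣ p ∣ → Nonempty p
  ∣p∣>0⇒Nonempty {p = p} ∣p∣>0 with nonempty? p
  ... | yes ne  = ne
  ... | no ¬ne = contradiction (Empty⇒∣p∣≡0 ¬ne) (>⇒≢ ∣p∣>0)

  ∣p∣+∣∁p∣≡k : ∀ (p : Subset k) → ∣ p ∣ + ∣ ∁ p ∣ ≡ k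
  ∣p∣+∣∁p∣≡k p = trans (cong (∣ p ∣ +_) (∣∁p∣≡n∸∣p∣ p)) (m+[n∸m]≡n (∣p∣≤n p))

  disjoint⇒∣p∪q∣≡∣p∣+∣q∣ : Empty (p ∩ q) → ∣ p ∪ q ∣ ≡ ∣ p ∣ + ∣ q ∣
  disjoint⇒∣p∪q∣≡∣p∣+∣q∣ {p = p} {q} p∩q≡∅ = begin
    ∣ p ∪ q ∣               ≡⟨ sym (+-identityʳ _) ⟩
    ∣ p ∪ q ∣ + 0           ≡⟨ cong (∣ p ∪ q ∣ +_) (sym (Empty⇒∣p∣≡0 p∩q≡∅)) ⟩
    ∣ p ∪ q ∣ + ∣ p ∩ q ∣   ≡⟨ ∣p∪q∣+∣p∩q∣≡∣p∣+∣q∣ p q ⟩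
    ∣ p ∣ + ∣ q ∣           ∎
    where open ≡-Reasoning

  p⊆q∧∣q∣≤∣p∣⇒q⊆p : p ⊆ q → ∣ q ∣ ≤ ∣ p ∣ → q ⊆ p
  p⊆q∧∣q∣≤∣p∣⇒q⊆p {p = p} p⊆q ∣q∣≤∣p∣ {x} x∈q with x ∈? p
  ... | yes x∈p = x∈p
  ... | no x∉p  = contradiction (p⊂q⇒∣p∣<∣q∣ (p⊆q , x , x∈q , x∉p)) (≤⇒≯ ∣q∣≤∣p∣)

  two-elements⇒∣p∣≥2 : ∀ {x y} → x ∈ p → y ∈ p → x ≢ y → 2 ≤ ∣ p ∣
  two-elements⇒∣p∣≥2 x∈p y∈p x≢y = subst (2 ≤_) (sym (x∈p⇒∣p∣≡1+∣p-x∣ x∈p))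
    (s≤s (Nonempty⇒∣p∣>0 (_ , x∈p∧x≢y⇒x∈p-y y∈p (x≢y ∘ sym))))

  all-equal⇒∣p∣≤1 : (∀ {x y} → x ∈ p → y ∈ p → x ≡ y) → ∣ p ∣ ≤ 1
  all-equal⇒∣p∣≤1 {p = p} all-equal with nonempty? p
  ... | no ¬ne        = subst (_≤ 1) (sym (Empty⇒∣p∣≡0 ¬ne)) z≤n
  ... | yes (x , x∈p) = subst (∣ p ∣ ≤_) (∣⁅x⁆∣≡1 x)
                          (p⊆q⇒∣p∣≤∣q∣ (λ y∈p → subst (_∈ ⁅ x ⁆) (all-equal x∈p y∈p) (x∈⁅x⁆ x)))

  subset-induction : ∀ {ℓ} (P : Subset k → Set ℓ) → P ⊥ →
                     (∀ {q x} → x ∉ q → P q → P (q ∪ ⁅ x ⁆)) → ∀ p → P p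
  subset-induction P P⊥ P-step p = go ∣ p ∣ p refl
    where
    go : ∀ s p → ∣ p ∣ ≡ s → P p
    go zero p ∣p∣≡0 with nonempty? p
    ... | yes ne  = contradiction (Nonempty⇒∣p∣>0 ne) (λ ∣p∣>0 → >⇒≢ ∣p∣>0 ∣p∣≡0)
    ... | no ¬ne = subst P (sym (Empty-unique ¬ne)) P⊥
    go (suc s) p ∣p∣≡1+s with nonempty? p
    ... | no ¬ne        = contradiction (trans (sym (Empty⇒∣p∣≡0 ¬ne)) ∣p∣≡1+s) (λ ())
    ... | yes (x , x∈p) = subst P (p-x∪⁅x⁆≡p x∈p)
          (P-step (λ x∈p-x → x∈p─q⇒x∉q {p = p} x∈p-x (x∈⁅x⁆ x))
                  (go s (p - x) (suc-injective (trans (sym (x∈p⇒∣p∣≡1+∣p-x∣ x∈p)) ∣p∣≡1+s))))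

  module _ {ℓ} {P : Subset k → Set ℓ} (P? : Relation.Unary.Decidable P) where

    max-card : ∀ {X} → P X → ∃ λ M → P M × (∀ {Y} → P Y → ∣ Y ∣ ≤ ∣ M ∣)
    max-card {X} PX = climb (k ∸ ∣ X ∣) PX (≤-reflexive (sym (m+[n∸m]≡n (∣p∣≤n X))))
      where
      climb : ∀ f {X} → P X → k ≤ ∣ X ∣ + f → ∃ λ M → P M × (∀ {Y} → P Y → ∣ Y ∣ ≤ ∣ M ∣)
      climb f {X} PX k≤ with anySubset? (λ Y → P? Y ×-dec (suc ∣ X ∣ ≤? ∣ Y ∣))
      ... | no ¬bigger = X , PX , (λ PY → ≮⇒≥ (λ ∣X∣<∣Y∣ → ¬bigger (_ , PY , ∣X∣<∣Y∣)))
      ... | yes (Y , PY , ∣X∣<∣Y∣) with f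
      ...   | zero  = contradiction (≤-trans ∣X∣<∣Y∣ (∣p∣≤n Y)) (≤⇒≯ (subst (k ≤_) (+-identityʳ _) k≤))
      ...   | suc f = climb f PY (≤-trans k≤ (subst (_≤ ∣ Y ∣ + f) (sym (+-suc ∣ X ∣ f)) (+-monoˡ-≤ f ∣X∣<∣Y∣)))

    minimal-⊆ : ∀ {X} → P X → ∃ λ M → M ⊆ X × P M × (∀ {Y} → Y ⊆ M → P Y → M ⊆ Y)
    minimal-⊆ {X} PX = descend ∣ X ∣ PX ≤-refl
      where
      descend : ∀ s {X} → P X → ∣ X ∣ ≤ s → ∃ λ M → M ⊆ X × P M × (∀ {Y} → Y ⊆ M → P Y → M ⊆ Y)
      descend s {X} PX ∣X∣≤s with anySubset? (λ Y → (Y ⊆? X) ×-dec P? Y ×-dec ¬? (X ⊆? Y))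
      ... | no ¬smaller = X , ⊆-refl , PX ,
                          (λ {Y} Y⊆X PY → decidable-stable (X ⊆? Y) (λ X⊈Y → ¬smaller (Y , Y⊆X , PY , X⊈Y)))
      ... | yes (Y , Y⊆X , PY , X⊈Y) with s | ≰⇒> (X⊈Y ∘ p⊆q∧∣q∣≤∣p∣⇒q⊆p Y⊆X)
      ...   | zero  | ∣Y∣<∣X∣ = contradiction (≤-trans ∣Y∣<∣X∣ ∣X∣≤s) λ ()
      ...   | suc s | ∣Y∣<∣X∣ with descend s PY (≤-pred (≤-trans ∣Y∣<∣X∣ ∣X∣≤s))
      ...     | M , M⊆Y , PM , minimal = M , ⊆-trans M⊆Y Y⊆X , PM , minimal

  -- Written as in `degree`, which therefore unfolds to a sum of brackets.
  𝟙 : Bool → ℕ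
  𝟙 b = if b then 1 else 0

  χ : Subset k → Fin k → ℕ
  χ p i = 𝟙 (lookup p i)

  𝟙*𝟙≡𝟙∧ : ∀ a b → 𝟙 a * 𝟙 b ≡ 𝟙 (a ∧ b)
  𝟙*𝟙≡𝟙∧ true  true  = refl
  𝟙*𝟙≡𝟙∧ true  false = refl
  𝟙*𝟙≡𝟙∧ false _     = refl

  sum-map-tabulate : ∀ {a} {A : Set a} (f : A → ℕ) (g : Fin k → A) →
                     sumᴸ (List.map f (List.tabulate g)) ≡ ∑[ i < k ] f (g i)
  sum-map-tabulate {zero}  f g = refl
  sum-map-tabulate {suc k} f g = cong (f (g zero) +_) (sum-map-tabulate f (g ∘ suc))

  ∣p∣≡∑ : ∀ (p : Subset k) → ∣ p ∣ ≡ ∑[ i < k ] χ p i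
  ∣p∣≡∑ []          = refl
  ∣p∣≡∑ (true ∷ p)  = cong suc (∣p∣≡∑ p)
  ∣p∣≡∑ (false ∷ p) = ∣p∣≡∑ p

  ∑-mono-≤ : ∀ {f g : Fin k → ℕ} → (∀ i → f i ≤ g i) → ∑[ i < k ] f i ≤ ∑[ i < k ] g i
  ∑-mono-≤ {zero}  f≤g = z≤n
  ∑-mono-≤ {suc k} f≤g = +-mono-≤ (f≤g zero) (∑-mono-≤ (f≤g ∘ suc))

  ∑-term≤ : ∀ (f : Fin k → ℕ) i → f i ≤ ∑[ j < k ] f j
  ∑-term≤ f zero    = m≤m+n (f zero) _
  ∑-term≤ f (suc i) = ≤-trans (∑-term≤ (f ∘ suc) i) (m≤n+m _ (f zero))

  ∑-point : ∀ (f : Fin k → ℕ) x → ∑[ v < k ] (f v * 𝟙 ⌊ x ≟ v ⌋) ≡ f x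
  ∑-point {suc k} f zero = begin
    f zero * 1 + ∑[ v < k ] (f (suc v) * 0) ≡⟨ cong₂ _+_ (*-identityʳ (f zero)) (sum-cong-≗ (*-zeroʳ ∘ f ∘ suc)) ⟩
    f zero + ∑[ v < k ] 0                   ≡⟨ cong (f zero +_) (sum-replicate-zero k) ⟩
    f zero + 0                              ≡⟨ +-identityʳ (f zero) ⟩
    f zero                                  ∎
    where open ≡-Reasoning
  ∑-point {suc k} f (suc x) = begin
    f zero * 0 + ∑[ v < k ] (f (suc v) * 𝟙 ⌊ suc x ≟ suc v ⌋)
      ≡⟨ cong (f zero * 0 +_) (sum-cong-≗ (λ v → cong (λ b → f (suc v) * 𝟙 b) (⌊suc≟suc⌋ x v))) ⟩
    f zero * 0 + ∑[ v < k ] (f (suc v) * 𝟙 ⌊ x ≟ v ⌋)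
      ≡⟨ cong₂ _+_ (*-zeroʳ (f zero)) (∑-point (f ∘ suc) x) ⟩
    f (suc x)
      ∎
    where open ≡-Reasoning

  ∑-lower-bound : ∀ {b} (d : Fin k → ℕ) → (∀ {v} → v ∈ p → b ≤ d v) → ∣ p ∣ * b ≤ ∑[ v < k ] (χ p v * d v)
  ∑-lower-bound {k} {p} {b} d b≤d = begin
    ∣ p ∣ * b                  ≡⟨ cong (_* b) (∣p∣≡∑ p) ⟩
    ∑[ v < k ] χ p v * b       ≡⟨ *-distribʳ-sum b (χ p) ⟩
    ∑[ v < k ] (χ p v * b)     ≤⟨ ∑-mono-≤ term ⟩
    ∑[ v < k ] (χ p v * d v)   ∎
    where
    open ≤-Reasoning
    term : ∀ v → χ p v * b ≤ χ p v * d v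
    term v with lookup p v in v∈p
    ... | true  = +-monoˡ-≤ 0 (b≤d (lookup⇒[]= v p v∈p))
    ... | false = z≤n

  double-counting : ∀ {l} (R : Subset k) (D : Subset l) (N : Fin k → Subset l) →
                    (∀ {r} → r ∈ R → 2 ≤ ∣ N r ∣) → (∀ {r} → r ∈ R → N r ⊆ D) →
                    (∀ {r r′ e} → r ∈ R → r′ ∈ R → e ∈ N r → e ∈ N r′ → r ≡ r′) →
                    2 * ∣ R ∣ ≤ ∣ D ∣
  double-counting {k} {l} R D N large within disjoint = begin
    2 * ∣ R ∣                                ≡⟨ cong (2 *_) (∣p∣≡∑ R) ⟩
    2 * ∑[ r < k ] χ R r                     ≡⟨ *-distribˡ-sum 2 (χ R) ⟩
    ∑[ r < k ] (2 * χ R r)                   ≤⟨ ∑-mono-≤ owned ⟩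
    ∑[ r < k ] (χ R r * ∑[ e < l ] χ (N r) e) ≡⟨ sum-cong-≗ (λ r → *-distribˡ-sum (χ R r) (χ (N r))) ⟩
    ∑[ r < k ] ∑[ e < l ] (χ R r * χ (N r) e) ≡⟨ ∑-comm (λ r e → χ R r * χ (N r) e) ⟩
    ∑[ e < l ] ∑[ r < k ] (χ R r * χ (N r) e) ≤⟨ ∑-mono-≤ owners ⟩
    ∑[ e < l ] χ D e                         ≡⟨ sym (∣p∣≡∑ D) ⟩
    ∣ D ∣                                    ∎
    where
    open ≤-Reasoning
    owned : ∀ r → 2 * χ R r ≤ χ R r * ∑[ e < l ] χ (N r) e
    owned r with lookup R r in r∈R
    ... | false = z≤n
    ... | true  = subst (2 ≤_) (trans (∣p∣≡∑ (N r)) (sym (+-identityʳ _))) (large (lookup⇒[]= r R r∈R))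
    owners : ∀ e → ∑[ r < k ] (χ R r * χ (N r) e) ≤ χ D e
    owners e = begin
      ∑[ r < k ] (χ R r * χ (N r) e)  ≡⟨ sum-cong-≗ (λ r → 𝟙*𝟙≡𝟙∧ (lookup R r) (lookup (N r) e)) ⟩
      ∑[ r < k ] 𝟙 (owns r)           ≡⟨ sum-cong-≗ (λ r → cong 𝟙 (sym (lookup∘tabulate owns r))) ⟩
      ∑[ r < k ] χ O r                ≡⟨ sym (∣p∣≡∑ O) ⟩
      ∣ O ∣                           ≤⟨ at-most-one ⟩
      χ D e                           ∎
      where
      owns : Fin k → Bool
      owns r = lookup R r ∧ lookup (N r) e
      O : Subset k
      O = tabulate owns
      owner : ∀ {r} → r ∈ O → r ∈ R × e ∈ N r
      owner {r} r∈O with ∧-true (∈-tabulate⁻ r∈O)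
      ... | r∈R , e∈Nr = lookup⇒[]= r R r∈R , lookup⇒[]= e (N r) e∈Nr
      at-most-one : ∣ O ∣ ≤ χ D e
      at-most-one with lookup D e in e∈D
      ... | true  = all-equal⇒∣p∣≤1 (λ r∈O r′∈O → disjoint (proj₁ (owner r∈O)) (proj₁ (owner r′∈O))
                                                          (proj₂ (owner r∈O)) (proj₂ (owner r′∈O)))
      ... | false = ≤-reflexive (Empty⇒∣p∣≡0 (λ (r , r∈O) → true≢false
                      (trans (sym ([]=⇒lookup (within (proj₁ (owner r∈O)) (proj₂ (owner r∈O))))) e∈D)))

  -- Until the sequence stabilises every step adds an element, so k steps reach its limit.
  module _ {k} (R : ℕ → Fin k → Bool)
           (R-mono : ∀ j x → R j x ≡ true → R (suc j) x ≡ true)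
           (R-stable : ∀ j → (∀ x → R (suc j) x ≡ R j x) → ∀ x → R (suc (suc j)) x ≡ R (suc j) x)
           where

    private
      Stable : ℕ → Set
      Stable j = ∀ x → R (suc j) x ≡ R j x

      R-mono-≤ : ∀ {i j} → i ≤ j → ∀ x → R i x ≡ true → R j x ≡ true
      R-mono-≤ {j = zero}  z≤n x r = r
      R-mono-≤ {j = suc j} i≤1+j x r with m≤n⇒m<n∨m≡n i≤1+j
      ... | inj₁ (s≤s i≤j) = R-mono j x (R-mono-≤ i≤j x r)
      ... | inj₂ refl      = r

      stable-from : ∀ {i} → Stable i → ∀ d → Stable (d + i)
      stable-from st zero    = st
      stable-from st (suc d) = R-stable _ (stable-from st d)

      stable-forever : ∀ {i} → Stable i → ∀ d x → R (d + i) x ≡ R i x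
      stable-forever st zero    x = refl
      stable-forever st (suc d) x = trans (stable-from st d x) (stable-forever st d x)

      grows-or-stabilises : ∀ j → (∃ λ i → i ≤ j × Stable i) ⊎ j ≤ ∣ tabulate (R j) ∣
      grows-or-stabilises zero = inj₂ z≤n
      grows-or-stabilises (suc j) with grows-or-stabilises j
      ... | inj₁ (i , i≤j , st) = inj₁ (i , m≤n⇒m≤1+n i≤j , st)
      ... | inj₂ j≤∣Rj∣ with all? (λ x → R (suc j) x Bool.≟ R j x)
      ... | yes st = inj₁ (j , n≤1+n j , st)
      ... | no ¬st with ¬∀⟶∃¬ k _ (λ x → R (suc j) x Bool.≟ R j x) ¬st
      ... | x , R≢ = inj₂ (≤-trans (s≤s j≤∣Rj∣) (p⊂q⇒∣p∣<∣q∣ (Rj⊆ , x , new)))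
        where
        Rj⊆ : tabulate (R j) ⊆ tabulate (R (suc j))
        Rj⊆ x∈ = ∈-tabulate⁺ (R-mono j _ (∈-tabulate⁻ x∈))
        new : x ∈ tabulate (R (suc j)) × x ∉ tabulate (R j)
        new with R j x in Rjx
        ... | true = contradiction (R-mono j x Rjx) R≢
        ... | false with R (suc j) x in R1+jx
        ...   | true  = ∈-tabulate⁺ R1+jx , λ x∈ → contradiction (trans (sym Rjx) (∈-tabulate⁻ x∈)) λ ()
        ...   | false = contradiction refl R≢

    saturates : ∀ j x → R j x ≡ true → R k x ≡ true
    saturates j x r with j ≤? k
    ... | yes j≤k = R-mono-≤ j≤k x r
    ... | no j≰k with grows-or-stabilises k
    ... | inj₁ (i , i≤k , st) = R-mono-≤ i≤k x
            (trans (sym (stable-forever st (j ∸ i) x))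
                   (subst (λ l → R l x ≡ true) (sym (m∸n+n≡m (≤-trans i≤k (<⇒≤ (≰⇒> j≰k))))) r))
    ... | inj₂ k≤∣Rk∣ = ∈-tabulate⁻ {f = R k} (p⊆q∧∣q∣≤∣p∣⇒q⊆p ⊆⊤ ∣⊤∣≤∣Rk∣ ∈⊤)
      where
      ∣⊤∣≤∣Rk∣ : ∣ ⊤ {k} ∣ ≤ ∣ tabulate (R k) ∣
      ∣⊤∣≤∣Rk∣ = subst (_≤ ∣ tabulate (R k) ∣) (sym (∣⊤∣≡n k)) k≤∣Rk∣

open FiniteSets

-- Walks and connectivity

module _ (G : Graph) where
  open Graph G

  data Link (e : Fin m) : Fin n → Fin n → Set where
    forward  : Link e (src G e) (tgt G e)
    backward : Link e (tgt G e) (src G e)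

  data Path (S : Subset n) (Y : Subset m) (u : Fin n) : Fin n → Set where
    start  : u ∈ S → Path S Y u u
    extend : ∀ {x v e} → Path S Y u x → e ∈ Y → Link e x v → v ∈ S → Path S Y u v

  private
    variable
      S : Subset n
      Y Y′ : Subset m
      e : Fin m
      u v x y : Fin n

  Link-sym : Link e x y → Link e y x
  Link-sym forward  = backward
  Link-sym backward = forward

  Path-start : Path S Y u v → u ∈ S
  Path-start (start u∈S)      = u∈S
  Path-start (extend p _ _ _) = Path-start p

  Path-end : Path S Y u v → v ∈ S
  Path-end (start u∈S)        = u∈S
  Path-end (extend _ _ _ v∈S) = v∈S

  Path-trans : Path S Y u x → Path S Y x v → Path S Y u v
  Path-trans p (start _)            = p
  Path-trans p (extend q e∈Y l v∈S) = extend (Path-trans p q) e∈Y l v∈S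

  Path-sym : Path S Y u v → Path S Y v u
  Path-sym (start u∈S)            = start u∈S
  Path-sym (extend p e∈Y l v∈S) = Path-trans (extend (start v∈S) e∈Y (Link-sym l) (Path-end p)) (Path-sym p)

  Path-⊆ : Y ⊆ Y′ → Path S Y u v → Path S Y′ u v
  Path-⊆ Y⊆Y′ (start u∈S)            = start u∈S
  Path-⊆ Y⊆Y′ (extend p e∈Y l v∈S) = extend (Path-⊆ Y⊆Y′ p) (Y⊆Y′ e∈Y) l v∈S

  Path-invariant : ∀ {ℓ} (P : Fin n → Set ℓ) →
                   (∀ {x v e} → e ∈ Y → Link e x v → v ∈ S → P x → P v) →
                   Path S Y u v → P u → P v
  Path-invariant P closed (start _)              Pu = Pu
  Path-invariant P closed (extend p e∈Y l v∈S) Pu = closed e∈Y l v∈S (Path-invariant P closed p Pu)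

  -- `reach (suc j) S Y u v` unfolds to `reach j S Y u v ∨ adjacentTo S Y (reach j S Y u) v`.
  adjacentTo : Subset n → Subset m → (Fin n → Bool) → Fin n → Bool
  adjacentTo S Y r v = any (λ e → lookup Y e ∧ lookup S v ∧
    ((⌊ tgt G e ≟ v ⌋ ∧ r (src G e)) ∨ (⌊ src G e ≟ v ⌋ ∧ r (tgt G e)))) (allFin m)

  adjacentTo⁺ : ∀ {r} → e ∈ Y → Link e x v → v ∈ S → r x ≡ true → adjacentTo S Y r v ≡ true
  adjacentTo⁺ {e = e} {Y = Y} {S = S} {r = r} e∈Y l v∈S rx = any-allFin⁺ e
    (subst₂ (λ a b → a ∧ b ∧ _ ≡ true) (sym ([]=⇒lookup e∈Y)) (sym ([]=⇒lookup v∈S)) (ends-match l rx))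
    where
    ends-match : ∀ {x v} → Link e x v → r x ≡ true →
                 ((⌊ tgt G e ≟ v ⌋ ∧ r (src G e)) ∨ (⌊ src G e ≟ v ⌋ ∧ r (tgt G e))) ≡ true
    ends-match forward  rx rewrite ⌊⌋-true⁺ (tgt G e ≟ tgt G e) refl | rx = refl
    ends-match backward rx rewrite ⌊⌋-true⁺ (src G e ≟ src G e) refl | rx = ∨-trueʳ refl

  adjacentTo⁻ : ∀ {r} → adjacentTo S Y r v ≡ true → ∃₂ λ e x → e ∈ Y × Link e x v × v ∈ S × r x ≡ true
  adjacentTo⁻ {S = S} {Y = Y} {v = v} adj with any-allFin⁻ adj
  ... | e , h with ∧-true h
  ... | Ye , h′ with ∧-true h′
  ... | Sv , h″ with ∨-true h″
  ... | inj₁ h₁ with ∧-true h₁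
  ...   | t≡v , rs with ⌊⌋-true⁻ (tgt G e ≟ v) t≡v
  ...     | refl = e , src G e , lookup⇒[]= e Y Ye , forward , lookup⇒[]= _ S Sv , rs
  adjacentTo⁻ {S = S} {Y = Y} {v = v} adj | e , h | Ye , h′ | Sv , h″ | inj₂ h₂ with ∧-true h₂
  ...   | s≡v , rt with ⌊⌋-true⁻ (src G e ≟ v) s≡v
  ...     | refl = e , tgt G e , lookup⇒[]= e Y Ye , backward , lookup⇒[]= _ S Sv , rt

  adjacentTo-cong : ∀ {r r′} → (∀ x → r x ≡ r′ x) → adjacentTo S Y r v ≡ adjacentTo S Y r′ v
  adjacentTo-cong {S = S} {Y = Y} {v = v} {r} {r′} r≗r′ = cong or (map-cong edge (allFin m))
    where
    edge : ∀ e → (lookup Y e ∧ lookup S v ∧ ((⌊ tgt G e ≟ v ⌋ ∧ r (src G e)) ∨ (⌊ src G e ≟ v ⌋ ∧ r (tgt G e))))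
               ≡ (lookup Y e ∧ lookup S v ∧ ((⌊ tgt G e ≟ v ⌋ ∧ r′ (src G e)) ∨ (⌊ src G e ≟ v ⌋ ∧ r′ (tgt G e))))
    edge e rewrite r≗r′ (src G e) | r≗r′ (tgt G e) = refl

  reach⇒Path : ∀ j → reach G j S Y u v ≡ true → Path S Y u v
  reach⇒Path {S = S} {u = u} {v = v} zero r with ∧-true r
  ... | u≡v , Sv with ⌊⌋-true⁻ (u ≟ v) u≡v
  ... | refl = start (lookup⇒[]= _ S Sv)
  reach⇒Path (suc j) r with ∨-true r
  ... | inj₁ r′  = reach⇒Path j r′
  ... | inj₂ adj with adjacentTo⁻ adj
  ... | e , x , e∈Y , l , v∈S , rx = extend (reach⇒Path j rx) e∈Y l v∈S

  Path⇒reach : Path S Y u v → ∃ λ j → reach G j S Y u v ≡ true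
  Path⇒reach {u = u} (start u∈S) = 0 , cong₂ _∧_ (⌊⌋-true⁺ (u ≟ u) refl) ([]=⇒lookup u∈S)
  Path⇒reach (extend p e∈Y l v∈S) with Path⇒reach p
  ... | j , r = suc j , ∨-trueʳ (adjacentTo⁺ e∈Y l v∈S r)

  conn⇒Path : conn G S Y u v ≡ true → Path S Y u v
  conn⇒Path = reach⇒Path n

  Path⇒conn : Path S Y u v → conn G S Y u v ≡ true
  Path⇒conn {S = S} {Y = Y} {u = u} {v = v} p with Path⇒reach p
  ... | j , r = saturates (λ j → reach G j S Y u) grows stable j v r
    where
    grows : ∀ j x → reach G j S Y u x ≡ true → reach G (suc j) S Y u x ≡ true
    grows j x r = cong (_∨ adjacentTo S Y (reach G j S Y u) x) r
    stable : ∀ j → (∀ x → reach G (suc j) S Y u x ≡ reach G j S Y u x) →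
             ∀ x → reach G (suc (suc j)) S Y u x ≡ reach G (suc j) S Y u x
    stable j st x = cong₂ _∨_ (st x) (adjacentTo-cong {S = S} {Y = Y} {v = x} st)

-- Connected components

module _ (G : Graph) where
  open Graph G

  private
    variable
      S : Subset n
      Y Y′ : Subset m
      e : Fin m
      u v x y r r′ : Fin n

    connectedBelow : Subset n → Subset m → Fin n → Fin n → Bool
    connectedBelow S Y v u = ⌊ u <? v ⌋ ∧ conn G S Y u v

  isRep : Subset n → Subset m → Fin n → Bool
  isRep S Y v = lookup S v ∧ not (any (connectedBelow S Y v) (allFin n))

  reps : Subset n → Subset m → Subset n
  reps S Y = tabulate (isRep S Y)

  comps≡∣reps∣ : ∀ S Y → comps G S Y ≡ ∣ reps S Y ∣
  comps≡∣reps∣ S Y = length-filter-tabulate (isRep S Y) id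

  ∈reps⁺ : v ∈ S → (∀ {u} → u Fin.< v → ¬ Path G S Y u v) → v ∈ reps S Y
  ∈reps⁺ {v = v} {S = S} {Y = Y} v∈S least = ∈-tabulate⁺
    (cong₂ (λ a b → a ∧ not b) ([]=⇒lookup v∈S) (any-allFin-false smaller-unreachable))
    where
    smaller-unreachable : ∀ u → connectedBelow S Y v u ≡ true → Data.Empty.⊥
    smaller-unreachable u h with ∧-true h
    ... | u<v , uv = least (⌊⌋-true⁻ (u <? v) u<v) (conn⇒Path G uv)

  ∈reps⁻ : v ∈ reps S Y → v ∈ S × (∀ {u} → u Fin.< v → ¬ Path G S Y u v)
  ∈reps⁻ {v = v} {S = S} {Y = Y} v∈ with ∧-true (∈-tabulate⁻ v∈)
  ... | v∈S , none = lookup⇒[]= v S v∈S , smaller-unreachable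
    where
    smaller-unreachable : ∀ {u} → u Fin.< v → ¬ Path G S Y u v
    smaller-unreachable {u} u<v p with trans (cong not (sym (any-allFin⁺ {f = connectedBelow S Y v} u
                                          (cong₂ _∧_ (⌊⌋-true⁺ (u <? v) u<v) (Path⇒conn G p))))) none
    ... | ()

  ∉reps⇒smaller : v ∈ S → v ∉ reps S Y → ∃ λ u → u Fin.< v × Path G S Y u v
  ∉reps⇒smaller {v = v} {S = S} {Y = Y} v∈S v∉ with any (connectedBelow S Y v) (allFin n) in any≡
  ... | false = contradiction (∈-tabulate⁺ (cong₂ (λ a b → a ∧ not b) ([]=⇒lookup v∈S) any≡)) v∉
  ... | true with any-allFin⁻ any≡
  ...   | u , h with ∧-true h
  ...     | u<v , uv = u , ⌊⌋-true⁻ (u <? v) u<v , conn⇒Path G uv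

  rep-exists : x ∈ S → ∃ λ r → r ∈ reps S Y × Path G S Y r x
  rep-exists {x = x} {S = S} {Y = Y} x∈S = descend x (<-wellFounded x) (start x∈S)
    where
    descend : ∀ v → Acc Fin._<_ v → Path G S Y v x → ∃ λ r → r ∈ reps S Y × Path G S Y r x
    descend v (acc smaller) p with v ∈? reps S Y
    ... | yes v∈ = v , v∈ , p
    ... | no v∉ with ∉reps⇒smaller (Path-start G p) v∉
    ...   | u , u<v , q = descend u (smaller u<v) (Path-trans G q p)

  rep-unique : r ∈ reps S Y → r′ ∈ reps S Y → Path G S Y r r′ → r ≡ r′
  rep-unique {r = r} {r′ = r′} r∈ r′∈ p with <-cmp r r′
  ... | tri< r<r′ _ _ = contradiction p (proj₂ (∈reps⁻ r′∈) r<r′)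
  ... | tri≈ _ r≡r′ _ = r≡r′
  ... | tri> _ _ r′<r = contradiction (Path-sym G p) (proj₂ (∈reps⁻ r∈) r′<r)

  rep-minimal : r ∈ reps S Y → Path G S Y u r → toℕ r ≤ toℕ u
  rep-minimal r∈ p = ≮⇒≥ (λ u<r → proj₂ (∈reps⁻ r∈) u<r p)

  comps>0 : Nonempty S → 0 < comps G S Y
  comps>0 {S = S} {Y = Y} (x , x∈S) with rep-exists {Y = Y} x∈S
  ... | r , r∈ , _ = subst (0 <_) (sym (comps≡∣reps∣ S Y)) (Nonempty⇒∣p∣>0 (r , r∈))

  comps≤n : ∀ S Y → comps G S Y ≤ n
  comps≤n S Y = subst (_≤ n) (sym (comps≡∣reps∣ S Y)) (∣p∣≤n (reps S Y))

  comps⊥≡0 : ∀ Y → comps G ⊥ Y ≡ 0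
  comps⊥≡0 Y = trans (comps≡∣reps∣ ⊥ Y) (Empty⇒∣p∣≡0 (λ (v , v∈) → ∉⊥ (proj₁ (∈reps⁻ v∈))))

  comps≡1⇒Path : comps G S Y ≡ 1 → x ∈ S → y ∈ S → Path G S Y x y
  comps≡1⇒Path {S = S} {Y = Y} {x} {y} one x∈S y∈S with rep-exists {Y = Y} x∈S | rep-exists {Y = Y} y∈S
  ... | r , r∈ , r→x | r′ , r′∈ , r′→y with r ≟ r′
  ... | yes refl = Path-trans G (Path-sym G r→x) r′→y
  ... | no r≢r′  = contradiction (subst (2 ≤_) (trans (sym (comps≡∣reps∣ S Y)) one)
                                        (two-elements⇒∣p∣≥2 r∈ r′∈ r≢r′)) λ { (s≤s ()) }

  reps-anti : Y ⊆ Y′ → reps S Y′ ⊆ reps S Y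
  reps-anti Y⊆Y′ v∈ with ∈reps⁻ v∈
  ... | v∈S , least = ∈reps⁺ v∈S (λ u<v p → least u<v (Path-⊆ G Y⊆Y′ p))

  data Via (Y : Subset m) (a b u v : Fin n) : Set where
    avoiding : Path G ⊤ Y u v → Via Y a b u v
    via-ab   : Path G ⊤ Y u a → Path G ⊤ Y b v → Via Y a b u v
    via-ba   : Path G ⊤ Y u b → Path G ⊤ Y a v → Via Y a b u v

  Via-swap : ∀ {a b} → Via Y a b u v → Via Y b a u v
  Via-swap (avoiding p) = avoiding p
  Via-swap (via-ab p q) = via-ba p q
  Via-swap (via-ba p q) = via-ab p q

  Path-∪⁅⁆ : Path G ⊤ (Y ∪ ⁅ e ⁆) u v → Via Y (src G e) (tgt G e) u v
  Path-∪⁅⁆ (start _) = avoiding (start ∈⊤)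
  Path-∪⁅⁆ {Y = Y} {e = e} (extend {e = f} p f∈ l _) with Path-∪⁅⁆ p | x∈p∪q⁻ Y ⁅ e ⁆ f∈
  ... | avoiding q | inj₁ f∈Y = avoiding (extend q f∈Y l ∈⊤)
  ... | via-ab q r | inj₁ f∈Y = via-ab q (extend r f∈Y l ∈⊤)
  ... | via-ba q r | inj₁ f∈Y = via-ba q (extend r f∈Y l ∈⊤)
  ... | IH         | inj₂ f∈⁅e⁆ with x∈⁅y⁆⇒x≡y e f∈⁅e⁆
  Path-∪⁅⁆ (extend p _ forward  _) | avoiding q | inj₂ _ | refl = via-ab q (start ∈⊤)
  Path-∪⁅⁆ (extend p _ backward _) | avoiding q | inj₂ _ | refl = via-ba q (start ∈⊤)
  Path-∪⁅⁆ (extend p _ forward  _) | via-ab q r | inj₂ _ | refl = via-ab q (start ∈⊤)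
  Path-∪⁅⁆ (extend p _ backward _) | via-ab q r | inj₂ _ | refl = avoiding q
  Path-∪⁅⁆ (extend p _ forward  _) | via-ba q r | inj₂ _ | refl = avoiding q
  Path-∪⁅⁆ (extend p _ backward _) | via-ba q r | inj₂ _ | refl = via-ba q (start ∈⊤)

  record Joins (Y Y′ : Subset m) (a b : Fin n) : Set where
    field
      included : Y ⊆ Y′
      joined   : Path G ⊤ Y′ a b
      split    : ∀ {u v} → Path G ⊤ Y′ u v → Via Y a b u v

  Joins-sym : ∀ {a b} → Joins Y Y′ a b → Joins Y Y′ b a
  Joins-sym J = record { included = included ; joined = Path-sym G joined ; split = Via-swap ∘ split }
    where open Joins J

  ∪⁅⁆-Joins : ∀ Y e → Joins Y (Y ∪ ⁅ e ⁆) (src G e) (tgt G e)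
  ∪⁅⁆-Joins Y e = record
    { included = p⊆p∪q ⁅ e ⁆
    ; joined   = extend (start ∈⊤) (q⊆p∪q Y ⁅ e ⁆ (x∈⁅x⁆ e)) forward ∈⊤
    ; split    = Path-∪⁅⁆
    }

  module _ {a b} (J : Joins Y Y′ a b) where
    open Joins J

    reps-join-connected : Path G ⊤ Y a b → reps ⊤ Y′ ≡ reps ⊤ Y
    reps-join-connected a→b = ⊆-antisym (reps-anti included) reps⊆
      where
      shortcut : Via Y a b u v → Path G ⊤ Y u v
      shortcut (avoiding p) = p
      shortcut (via-ab p q) = Path-trans G p (Path-trans G a→b q)
      shortcut (via-ba p q) = Path-trans G p (Path-trans G (Path-sym G a→b) q)
      reps⊆ : reps ⊤ Y ⊆ reps ⊤ Y′
      reps⊆ v∈ with ∈reps⁻ v∈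
      ... | v∈⊤ , least = ∈reps⁺ v∈⊤ (λ u<v p → least u<v (shortcut (split p)))

    -- Joining the components of r < r′ only stops r′ from being the least vertex of its component.
    reps-join-ordered : r ∈ reps ⊤ Y → Path G ⊤ Y r a → r′ ∈ reps ⊤ Y → Path G ⊤ Y r′ b →
                        r Fin.< r′ → reps ⊤ Y′ ≡ reps ⊤ Y - r′
    reps-join-ordered {r} {r′} r∈ r→a r′∈ r′→b r<r′ = ⊆-antisym reps⊆ reps⊇
      where
      r→r′ : Path G ⊤ Y′ r r′
      r→r′ = Path-trans G (Path-⊆ G included r→a)
                          (Path-trans G joined (Path-sym G (Path-⊆ G included r′→b)))
      reps⊆ : reps ⊤ Y′ ⊆ reps ⊤ Y - r′
      reps⊆ {v} v∈ with v ≟ r′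
      ... | yes refl = contradiction r→r′ (proj₂ (∈reps⁻ v∈) r<r′)
      ... | no v≢r′  = x∈p∧x≢y⇒x∈p-y (reps-anti included v∈) v≢r′
      reps⊇ : reps ⊤ Y - r′ ⊆ reps ⊤ Y′
      reps⊇ {v} v∈ = ∈reps⁺ ∈⊤ (λ u<v p → unreachable u<v (split p))
        where
        v∈Y : v ∈ reps ⊤ Y
        v∈Y = p─q⊆p _ _ v∈
        v≢r′ : v ≢ r′
        v≢r′ refl = x∈p─q⇒x∉q v∈ (x∈⁅x⁆ r′)
        unreachable : ∀ {u} → u Fin.< v → ¬ Via Y a b u v
        unreachable u<v (avoiding p) = proj₂ (∈reps⁻ v∈Y) u<v p
        unreachable u<v (via-ab p q) = v≢r′ (sym (rep-unique r′∈ v∈Y (Path-trans G r′→b q)))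
        unreachable {u} u<v (via-ba p q) with rep-unique r∈ v∈Y (Path-trans G r→a q)
        ... | refl = <-irrefl refl
                       (≤-trans r<r′ (≤-trans (rep-minimal r′∈ (Path-trans G p (Path-sym G r′→b))) (<⇒≤ u<v)))

  private
    c-drop-rep : ∀ {w} → w ∈ reps ⊤ Y → reps ⊤ Y′ ≡ reps ⊤ Y - w → c G Y ≡ suc (c G Y′)
    c-drop-rep {Y = Y} {Y′ = Y′} {w} w∈ reps≡ = begin
      c G Y                ≡⟨ comps≡∣reps∣ ⊤ Y ⟩
      ∣ reps ⊤ Y ∣         ≡⟨ x∈p⇒∣p∣≡1+∣p-x∣ w∈ ⟩
      suc ∣ reps ⊤ Y - w ∣ ≡⟨ cong (suc ∘ ∣_∣) (sym reps≡) ⟩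
      suc ∣ reps ⊤ Y′ ∣    ≡⟨ cong suc (sym (comps≡∣reps∣ ⊤ Y′)) ⟩
      suc (c G Y′)         ∎
      where open ≡-Reasoning

  c-join-separate : ∀ {a b} → Joins Y Y′ a b → ¬ Path G ⊤ Y a b → c G Y ≡ suc (c G Y′)
  c-join-separate {Y = Y} {Y′ = Y′} {a} {b} J a↛b
    with rep-exists {Y = Y} (∈⊤ {x = a}) | rep-exists {Y = Y} (∈⊤ {x = b})
  ... | r , r∈ , r→a | r′ , r′∈ , r′→b with <-cmp r r′
  ... | tri< r<r′ _ _ = c-drop-rep r′∈ (reps-join-ordered J r∈ r→a r′∈ r′→b r<r′)
  ... | tri> _ _ r′<r = c-drop-rep r∈ (reps-join-ordered (Joins-sym J) r′∈ r′→b r∈ r→a r′<r)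
  ... | tri≈ _ refl _ = contradiction (Path-trans G (Path-sym G r→a) r′→b) a↛b

  separated : Subset m → Fin m → ℕ
  separated Y e = 𝟙 (not (conn G ⊤ Y (src G e) (tgt G e)))

  separated≤1 : ∀ Y e → separated Y e ≤ 1
  separated≤1 Y e with conn G ⊤ Y (src G e) (tgt G e)
  ... | true  = z≤n
  ... | false = ≤-refl

  separated-anti : ∀ {Y Z} e → Y ⊆ Z → separated Z e ≤ separated Y e
  separated-anti {Y} {Z} e Y⊆Z with conn G ⊤ Y (src G e) (tgt G e) in Y-conn
  ... | false = separated≤1 Z e
  ... | true rewrite Path⇒conn G (Path-⊆ G Y⊆Z (conn⇒Path G Y-conn)) = z≤n

  c-∪⁅⁆ : ∀ Y e → c G Y ≡ c G (Y ∪ ⁅ e ⁆) + separated Y e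
  c-∪⁅⁆ Y e with conn G ⊤ Y (src G e) (tgt G e) in connected
  ... | true  = begin
    c G Y                   ≡⟨ comps≡∣reps∣ ⊤ Y ⟩
    ∣ reps ⊤ Y ∣            ≡⟨ cong ∣_∣ (sym (reps-join-connected (∪⁅⁆-Joins Y e) (conn⇒Path G connected))) ⟩
    ∣ reps ⊤ (Y ∪ ⁅ e ⁆) ∣  ≡⟨ sym (comps≡∣reps∣ ⊤ (Y ∪ ⁅ e ⁆)) ⟩
    c G (Y ∪ ⁅ e ⁆)         ≡⟨ sym (+-identityʳ _) ⟩
    c G (Y ∪ ⁅ e ⁆) + 0     ∎
    where open ≡-Reasoning
  ... | false = trans (c-join-separate (∪⁅⁆-Joins Y e) (λ p → true≢false (trans (sym (Path⇒conn G p)) connected)))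
                      (+-comm 1 _)

  ∈δ⁻ : ∀ {A} → e ∈ δ G A → src G e ∈ A ⊎ tgt G e ∈ A
  ∈δ⁻ {A = A} e∈ with ∨-true (∈-tabulate⁻ e∈)
  ... | inj₁ s∈A = inj₁ (lookup⇒[]= _ A s∈A)
  ... | inj₂ t∈A = inj₂ (lookup⇒[]= _ A t∈A)

  ∈δ⁺ : ∀ {A} → src G e ∈ A ⊎ tgt G e ∈ A → e ∈ δ G A
  ∈δ⁺ {e = e} {A} (inj₁ s∈A) = ∈-tabulate⁺ (cong (_∨ lookup A (tgt G e)) ([]=⇒lookup s∈A))
  ∈δ⁺ (inj₂ t∈A) = ∈-tabulate⁺ (∨-trueʳ ([]=⇒lookup t∈A))

  Link-∉δ : ∀ {A} → Link G e x y → e ∉ δ G A → x ∉ A × y ∉ A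
  Link-∉δ forward  e∉ = (e∉ ∘ ∈δ⁺ ∘ inj₁) , (e∉ ∘ ∈δ⁺ ∘ inj₂)
  Link-∉δ backward e∉ = (e∉ ∘ ∈δ⁺ ∘ inj₂) , (e∉ ∘ ∈δ⁺ ∘ inj₁)

  Link-∉⇒∉δ : ∀ {A} → Link G e x y → x ∉ A → y ∉ A → e ∉ δ G A
  Link-∉⇒∉δ forward  s∉ t∉ e∈ = [ s∉ , t∉ ]′ (∈δ⁻ e∈)
  Link-∉⇒∉δ backward t∉ s∉ e∈ = [ s∉ , t∉ ]′ (∈δ⁻ e∈)

  Link-∈δ : ∀ {A} → Link G e x y → x ∈ A ⊎ y ∈ A → e ∈ δ G A
  Link-∈δ forward  = ∈δ⁺
  Link-∈δ backward = ∈δ⁺ ∘ Data.Sum.swap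

  module _ {A : Subset n} where

    isolated : v ∈ A → Path G ⊤ (∁ (δ G A)) u v → u ≡ v
    isolated {v} v∈A p = Path-invariant G (_≡ v) stays (Path-sym G p) refl
      where
      stays : ∀ {x w e} → e ∈ ∁ (δ G A) → Link G e x w → w ∈ ⊤ → x ≡ v → w ≡ v
      stays e∈ l _ refl = contradiction v∈A (proj₁ (Link-∉δ l (x∈∁p⇒x∉p e∈)))

    Path-∁δ⇒induced : Path G ⊤ (∁ (δ G A)) u v → v ∉ A → Path G (∁ A) ⊤ u v
    Path-∁δ⇒induced (start _) u∉A = start (x∉p⇒x∈∁p u∉A)
    Path-∁δ⇒induced (extend p e∈ l _) v∉A =
      extend (Path-∁δ⇒induced p (proj₁ (Link-∉δ l (x∈∁p⇒x∉p e∈)))) ∈⊤ l (x∉p⇒x∈∁p v∉A)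

    Path-induced⇒∁δ : Path G (∁ A) ⊤ u v → Path G ⊤ (∁ (δ G A)) u v
    Path-induced⇒∁δ (start _) = start ∈⊤
    Path-induced⇒∁δ (extend p _ l v∈) = extend (Path-induced⇒∁δ p)
      (x∉p⇒x∈∁p (Link-∉⇒∉δ l (x∈∁p⇒x∉p (Path-end G p)) (x∈∁p⇒x∉p v∈))) l ∈⊤

    reps-∁δ : reps ⊤ (∁ (δ G A)) ≡ A ∪ reps (∁ A) ⊤
    reps-∁δ = ⊆-antisym reps⊆ reps⊇
      where
      reps⊆ : reps ⊤ (∁ (δ G A)) ⊆ A ∪ reps (∁ A) ⊤
      reps⊆ {v} v∈ with v ∈? A
      ... | yes v∈A = x∈p∪q⁺ (inj₁ v∈A)
      ... | no v∉A  = x∈p∪q⁺ (inj₂ (∈reps⁺ (x∉p⇒x∈∁p v∉A)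
                        (λ u<v p → proj₂ (∈reps⁻ v∈) u<v (Path-induced⇒∁δ p))))
      reps⊇ : A ∪ reps (∁ A) ⊤ ⊆ reps ⊤ (∁ (δ G A))
      reps⊇ v∈ with x∈p∪q⁻ A _ v∈
      ... | inj₁ v∈A = ∈reps⁺ ∈⊤ (λ u<v p → <-irrefl (cong toℕ (isolated v∈A p)) u<v)
      ... | inj₂ v∈R with ∈reps⁻ v∈R
      ...   | v∈∁A , least =
        ∈reps⁺ ∈⊤ (λ u<v p → least u<v (Path-∁δ⇒induced p (x∈∁p⇒x∉p v∈∁A)))

    c-∁δ : c G (∁ (δ G A)) ≡ ∣ A ∣ + ω G (∁ A)
    c-∁δ = begin
      c G (∁ (δ G A))              ≡⟨ comps≡∣reps∣ ⊤ _ ⟩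
      ∣ reps ⊤ (∁ (δ G A)) ∣       ≡⟨ cong ∣_∣ reps-∁δ ⟩
      ∣ A ∪ reps (∁ A) ⊤ ∣         ≡⟨ disjoint⇒∣p∪q∣≡∣p∣+∣q∣ disjoint ⟩
      ∣ A ∣ + ∣ reps (∁ A) ⊤ ∣     ≡⟨ cong (∣ A ∣ +_) (sym (comps≡∣reps∣ (∁ A) ⊤)) ⟩
      ∣ A ∣ + ω G (∁ A)            ∎
      where
      open ≡-Reasoning
      disjoint : Empty (A ∩ reps (∁ A) ⊤)
      disjoint (v , v∈) with x∈p∩q⁻ A _ v∈
      ... | v∈A , v∈R = x∈∁p⇒x∉p (proj₁ (∈reps⁻ v∈R)) v∈A

  Path-⊥ : Path G S ⊥ u v → u ≡ v
  Path-⊥ (start _)          = refl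
  Path-⊥ (extend _ e∈⊥ _ _) = contradiction e∈⊥ ∉⊥

  c⊥≡n : c G ⊥ ≡ n
  c⊥≡n = begin
    c G ⊥          ≡⟨ comps≡∣reps∣ ⊤ ⊥ ⟩
    ∣ reps ⊤ ⊥ ∣   ≡⟨ cong ∣_∣ (⊆-antisym ⊆⊤ (λ _ → ∈reps⁺ ∈⊤ no-smaller)) ⟩
    ∣ ⊤ {n} ∣      ≡⟨ ∣⊤∣≡n n ⟩
    n              ∎
    where
    open ≡-Reasoning
    no-smaller : ∀ {u v} → u Fin.< v → ¬ Path G ⊤ ⊥ u v
    no-smaller u<v p = <-irrefl (cong toℕ (Path-⊥ p)) u<v

-- The cographic rank

module _ (G : Graph) where
  open Graph G

  c-∪-bound : ∀ T Y → c G Y ≤ c G (Y ∪ T) + ∣ T ∣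
  c-∪-bound = subset-induction (λ T → ∀ Y → c G Y ≤ c G (Y ∪ T) + ∣ T ∣) base step
    where
    base : ∀ Y → c G Y ≤ c G (Y ∪ ⊥) + ∣ ⊥ {m} ∣
    base Y rewrite ∪-identityʳ Y | ∣⊥∣≡0 m | +-identityʳ (c G Y) = ≤-refl
    step : ∀ {T x} → x ∉ T → (∀ Y → c G Y ≤ c G (Y ∪ T) + ∣ T ∣) →
           ∀ Y → c G Y ≤ c G (Y ∪ (T ∪ ⁅ x ⁆)) + ∣ T ∪ ⁅ x ⁆ ∣
    step {T} {x} x∉T IH Y = begin
      c G Y                                    ≤⟨ IH Y ⟩
      c G (Y ∪ T) + ∣ T ∣                      ≡⟨ cong (_+ ∣ T ∣) (c-∪⁅⁆ G (Y ∪ T) x) ⟩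
      c G Y₁ + separated G (Y ∪ T) x + ∣ T ∣   ≤⟨ +-monoˡ-≤ ∣ T ∣ (+-monoʳ-≤ (c G Y₁) (separated≤1 G (Y ∪ T) x)) ⟩
      c G Y₁ + 1 + ∣ T ∣                       ≡⟨ +-assoc (c G Y₁) 1 ∣ T ∣ ⟩
      c G Y₁ + suc ∣ T ∣                       ≡⟨ cong₂ _+_ (cong (c G) (∪-assoc Y T ⁅ x ⁆))
                                                            (sym (x∉p⇒∣p∪⁅x⁆∣≡1+∣p∣ x∉T)) ⟩
      c G (Y ∪ (T ∪ ⁅ x ⁆)) + ∣ T ∪ ⁅ x ⁆ ∣    ∎
      where
      open ≤-Reasoning
      Y₁ = (Y ∪ T) ∪ ⁅ x ⁆

  c-supermodular : ∀ T {Y Z} → Y ⊆ Z → c G Z + c G (Y ∪ T) ≤ c G Y + c G (Z ∪ T)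
  c-supermodular = subset-induction P base step
    where
    P : Subset m → Set
    P T = ∀ {Y Z} → Y ⊆ Z → c G Z + c G (Y ∪ T) ≤ c G Y + c G (Z ∪ T)
    base : P ⊥
    base {Y} {Z} _ rewrite ∪-identityʳ Y | ∪-identityʳ Z = ≤-reflexive (+-comm (c G Z) (c G Y))
    step : ∀ {T x} → x ∉ T → P T → P (T ∪ ⁅ x ⁆)
    step {T} {x} _ IH {Y} {Z} Y⊆Z = +-cancelʳ-≤ s _ _ (begin
      c G Z + c G (Y ∪ (T ∪ ⁅ x ⁆)) + s              ≡⟨ cong (λ W → c G Z + c G W + s) (sym (∪-assoc Y T ⁅ x ⁆)) ⟩
      c G Z + c G (Y₁ ∪ ⁅ x ⁆) + s                   ≡⟨ +-assoc (c G Z) _ s ⟩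
      c G Z + (c G (Y₁ ∪ ⁅ x ⁆) + s)                 ≡⟨ cong (c G Z +_) (sym (c-∪⁅⁆ G Y₁ x)) ⟩
      c G Z + c G Y₁                                 ≤⟨ IH Y⊆Z ⟩
      c G Y + c G Z₁                                 ≡⟨ cong (c G Y +_) (c-∪⁅⁆ G Z₁ x) ⟩
      c G Y + (c G (Z₁ ∪ ⁅ x ⁆) + separated G Z₁ x)  ≤⟨ +-monoʳ-≤ (c G Y) (+-monoʳ-≤ (c G (Z₁ ∪ ⁅ x ⁆))
                                                                          (separated-anti G x Y₁⊆Z₁)) ⟩
      c G Y + (c G (Z₁ ∪ ⁅ x ⁆) + s)                 ≡⟨ sym (+-assoc (c G Y) _ s) ⟩
      c G Y + c G (Z₁ ∪ ⁅ x ⁆) + s                   ≡⟨ cong (λ W → c G Y + c G W + s) (∪-assoc Z T ⁅ x ⁆) ⟩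
      c G Y + c G (Z ∪ (T ∪ ⁅ x ⁆)) + s              ∎)
      where
      open ≤-Reasoning
      Y₁ = Y ∪ T
      Z₁ = Z ∪ T
      s = separated G Y₁ x
      Y₁⊆Z₁ : Y₁ ⊆ Z₁
      Y₁⊆Z₁ v∈ = [ p⊆p∪q T ∘ Y⊆Z , q⊆p∪q Z T ]′ (x∈p∪q⁻ Y T v∈)

  module _ (connected : Connected G) where

    private
      1≤n : 1 ≤ n
      1≤n = subst (_≤ n) connected (comps≤n G ⊤ ⊤)

      -- `rank* G X + c G (∁ X)` has this shape, with k = c G (∁ X), once c G ⊤ ≡ 1.
      untruncate : ∀ a k n → 1 ≤ n → k ≤ n → k ≤ a + 1 → a + (n ∸ k) ∸ (n ∸ 1) + k ≡ a + 1
      untruncate a k (suc n′) _ k≤n k≤a+1 = begin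
        a + (suc n′ ∸ k) ∸ n′ + k    ≡⟨ cong (λ z → z ∸ n′ + k) (sym (+-∸-assoc a k≤n)) ⟩
        a + suc n′ ∸ k ∸ n′ + k      ≡⟨ cong (λ z → z ∸ k ∸ n′ + k) (sym (+-assoc a 1 n′)) ⟩
        a + 1 + n′ ∸ k ∸ n′ + k      ≡⟨ cong (λ z → z ∸ n′ + k) (+-∸-comm n′ k≤a+1) ⟩
        a + 1 ∸ k + n′ ∸ n′ + k      ≡⟨ cong (_+ k) (m+n∸n≡m (a + 1 ∸ k) n′) ⟩
        a + 1 ∸ k + k                ≡⟨ m∸n+n≡m k≤a+1 ⟩
        a + 1                        ∎
        where open ≡-Reasoning

    c-∁-bound : ∀ X → c G (∁ X) ≤ ∣ X ∣ + 1
    c-∁-bound X = begin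
      c G (∁ X)             ≤⟨ c-∪-bound X (∁ X) ⟩
      c G (∁ X ∪ X) + ∣ X ∣ ≡⟨ cong (λ Y → c G Y + ∣ X ∣) (∪-inverseˡ X) ⟩
      c G ⊤ + ∣ X ∣         ≡⟨ cong (_+ ∣ X ∣) connected ⟩
      1 + ∣ X ∣             ≡⟨ +-comm 1 ∣ X ∣ ⟩
      ∣ X ∣ + 1             ∎
      where open ≤-Reasoning

    rank*+c : ∀ X → rank* G X + c G (∁ X) ≡ ∣ X ∣ + 1
    rank*+c X = begin
      ∣ X ∣ + (n ∸ k) ∸ (n ∸ c G ⊤) + k  ≡⟨ cong (λ z → ∣ X ∣ + (n ∸ k) ∸ (n ∸ z) + k) connected ⟩
      ∣ X ∣ + (n ∸ k) ∸ (n ∸ 1) + k      ≡⟨ untruncate ∣ X ∣ k n 1≤n (comps≤n G ⊤ (∁ X)) (c-∁-bound X) ⟩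
      ∣ X ∣ + 1                          ∎
      where
      open ≡-Reasoning
      k = c G (∁ X)

    rank*-mono : ∀ {X X′} → X ⊆ X′ → rank* G X ≤ rank* G X′
    rank*-mono {X} {X′} X⊆X′ = +-cancelʳ-≤ (c G (∁ X) + d) _ _ (begin
      rank* G X + (c G (∁ X) + d)   ≡⟨ sym (+-assoc (rank* G X) _ d) ⟩
      rank* G X + c G (∁ X) + d     ≡⟨ cong (_+ d) (rank*+c X) ⟩
      ∣ X ∣ + 1 + d                 ≡⟨ xy∙z≈xz∙y ∣ X ∣ 1 d ⟩
      ∣ X ∣ + d + 1                 ≡⟨ cong (_+ 1) (sym (q⊆p⇒∣p∣≡∣q∣+∣p─q∣ X⊆X′)) ⟩
      ∣ X′ ∣ + 1                    ≡⟨ sym (rank*+c X′) ⟩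
      rank* G X′ + c G (∁ X′)       ≤⟨ +-monoʳ-≤ (rank* G X′) c∁X′≤ ⟩
      rank* G X′ + (c G (∁ X) + d)  ∎)
      where
      open ≤-Reasoning
      d = ∣ X′ ─ X ∣
      ∁X′∪[X′─X]≡∁X : ∁ X′ ∪ (X′ ─ X) ≡ ∁ X
      ∁X′∪[X′─X]≡∁X = ⊆-antisym ⊆∁X ∁X⊆
        where
        ⊆∁X : ∁ X′ ∪ (X′ ─ X) ⊆ ∁ X
        ⊆∁X v∈ with x∈p∪q⁻ (∁ X′) (X′ ─ X) v∈
        ... | inj₁ v∈∁X′  = x∉p⇒x∈∁p (x∈∁p⇒x∉p v∈∁X′ ∘ X⊆X′)
        ... | inj₂ v∈X′─X = x∉p⇒x∈∁p (x∈p─q⇒x∉q v∈X′─X)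
        ∁X⊆ : ∁ X ⊆ ∁ X′ ∪ (X′ ─ X)
        ∁X⊆ {v} v∈∁X with v ∈? X′
        ... | yes v∈X′ = q⊆p∪q (∁ X′) _ (x∈p∧x∉q⇒x∈p─q v∈X′ (x∈∁p⇒x∉p v∈∁X))
        ... | no v∉X′  = p⊆p∪q (X′ ─ X) (x∉p⇒x∈∁p v∉X′)
      c∁X′≤ : c G (∁ X′) ≤ c G (∁ X) + d
      c∁X′≤ = subst (λ Y → c G (∁ X′) ≤ c G Y + d) ∁X′∪[X′─X]≡∁X (c-∪-bound (X′ ─ X) (∁ X′))

    rank*-submodular : ∀ X X′ → rank* G (X ∪ X′) + rank* G (X ∩ X′) ≤ rank* G X + rank* G X′
    rank*-submodular X X′ = +-cancelʳ-≤ (c∪ + c∩) _ _ (begin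
      r∪ + r∩ + (c∪ + c∩)                    ≡⟨ interchange r∪ r∩ c∪ c∩ ⟩
      (r∪ + c∪) + (r∩ + c∩)                  ≡⟨ cong₂ _+_ (rank*+c (X ∪ X′)) (rank*+c (X ∩ X′)) ⟩
      (∣ X ∪ X′ ∣ + 1) + (∣ X ∩ X′ ∣ + 1)    ≡⟨ interchange (∣ X ∪ X′ ∣) 1 (∣ X ∩ X′ ∣) 1 ⟩
      (∣ X ∪ X′ ∣ + ∣ X ∩ X′ ∣) + 2          ≡⟨ cong (_+ 2) (∣p∪q∣+∣p∩q∣≡∣p∣+∣q∣ X X′) ⟩
      (∣ X ∣ + ∣ X′ ∣) + 2                   ≡⟨ interchange (∣ X ∣) (∣ X′ ∣) 1 1 ⟩
      (∣ X ∣ + 1) + (∣ X′ ∣ + 1)             ≡⟨ sym (cong₂ _+_ (rank*+c X) (rank*+c X′)) ⟩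
      (r + c G (∁ X)) + (r′ + c G (∁ X′))    ≡⟨ interchange r _ r′ _ ⟩
      r + r′ + (c G (∁ X) + c G (∁ X′))      ≤⟨ +-monoʳ-≤ (r + r′) supermodular ⟩
      r + r′ + (c∪ + c∩)                     ∎)
      where
      open ≤-Reasoning
      open BooleanAlgebraProperties (∪-∩-booleanAlgebra m) using (deMorgan₁; deMorgan₂)
      r = rank* G X
      r′ = rank* G X′
      r∪ = rank* G (X ∪ X′)
      r∩ = rank* G (X ∩ X′)
      c∪ = c G (∁ (X ∪ X′))
      c∩ = c G (∁ (X ∩ X′))
      ∁[X∪X′]∪∁X′≡∁X′ : ∁ (X ∪ X′) ∪ ∁ X′ ≡ ∁ X′
      ∁[X∪X′]∪∁X′≡∁X′ = trans (cong (_∪ ∁ X′) (deMorgan₂ X X′)) (trans (∪-comm (∁ X ∩ ∁ X′) (∁ X′))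
                          (trans (cong (∁ X′ ∪_) (∩-comm (∁ X) (∁ X′))) (∪-abs-∩ (∁ X′) (∁ X))))
      supermodular : c G (∁ X) + c G (∁ X′) ≤ c∪ + c∩
      supermodular = subst₂ (λ Y Z → c G (∁ X) + c G Y ≤ c∪ + c G Z) ∁[X∪X′]∪∁X′≡∁X′ (sym (deMorgan₁ X X′))
        (c-supermodular (∁ X′) (λ v∈ → x∉p⇒x∈∁p (x∈∁p⇒x∉p v∈ ∘ p⊆p∪q X′)))

-- Degrees

module _ (G : Graph) where
  open Graph G

  edgesIn : Subset n → Subset m
  edgesIn A = ∁ (δ G (∁ A))

  lookup-δ : ∀ A e → lookup (δ G A) e ≡ lookup A (src G e) ∨ lookup A (tgt G e)
  lookup-δ A e = lookup∘tabulate _ e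

  lookup-edgesIn : ∀ A e → lookup (edgesIn A) e ≡ lookup A (src G e) ∧ lookup A (tgt G e)
  lookup-edgesIn A e rewrite lookup-map e not (δ G (∁ A)) | lookup-δ (∁ A) e
                           | lookup-map (src G e) not A | lookup-map (tgt G e) not A
    with lookup A (src G e) | lookup A (tgt G e)
  ... | true  | true  = refl
  ... | true  | false = refl
  ... | false | _     = refl

  ∈edgesIn⁻ : ∀ A {e} → e ∈ edgesIn A → src G e ∈ A × tgt G e ∈ A
  ∈edgesIn⁻ A {e} e∈ with ∧-true (trans (sym (lookup-edgesIn A e)) ([]=⇒lookup e∈))
  ... | s∈A , t∈A = lookup⇒[]= _ A s∈A , lookup⇒[]= _ A t∈A

  ∈edgesIn⁺ : ∀ {A e} → src G e ∈ A → tgt G e ∈ A → e ∈ edgesIn A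
  ∈edgesIn⁺ {A} {e} s∈A t∈A = lookup⇒[]= e (edgesIn A)
    (trans (lookup-edgesIn A e) (cong₂ _∧_ ([]=⇒lookup s∈A) ([]=⇒lookup t∈A)))

  edgesIn⊆δ : ∀ A → edgesIn A ⊆ δ G A
  edgesIn⊆δ A {e} e∈ = ∈δ⁺ G (inj₁ (proj₁ (∈edgesIn⁻ A e∈)))

  endsAt : Fin m → Fin n → ℕ
  endsAt e v = 𝟙 ⌊ src G e ≟ v ⌋ + 𝟙 ⌊ tgt G e ≟ v ⌋

  degreeIn : Subset m → Fin n → ℕ
  degreeIn Y v = ∑[ e < m ] (χ Y e * endsAt e v)

  degree≡degreeIn⊤ : ∀ v → degree G v ≡ degreeIn ⊤ v
  degree≡degreeIn⊤ v = trans (sum-map-tabulate (λ e → endsAt e v) id)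
    (sum-cong-≗ (λ e → sym (trans (cong (λ b → 𝟙 b * endsAt e v) (lookup-replicate e true)) (*-identityˡ _))))

  handshake : ∀ A Y → ∑[ v < n ] (χ A v * degreeIn Y v) ≡ ∑[ e < m ] (χ Y e * (χ A (src G e) + χ A (tgt G e)))
  handshake A Y = begin
    ∑[ v < n ] (χ A v * ∑[ e < m ] (χ Y e * endsAt e v))  ≡⟨ sum-cong-≗ (λ v → *-distribˡ-sum (χ A v) (through v)) ⟩
    ∑[ v < n ] ∑[ e < m ] (χ A v * (χ Y e * endsAt e v))  ≡⟨ ∑-comm (λ v e → χ A v * (χ Y e * endsAt e v)) ⟩
    ∑[ e < m ] ∑[ v < n ] (χ A v * (χ Y e * endsAt e v))  ≡⟨ sum-cong-≗ per-edge ⟩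
    ∑[ e < m ] (χ Y e * (χ A (src G e) + χ A (tgt G e)))  ∎
    where
    open ≡-Reasoning
    through : Fin n → Fin m → ℕ
    through v e = χ Y e * endsAt e v
    regroup : ∀ α η p q → α * (η * (p + q)) ≡ η * (α * p + α * q)
    regroup α η p q = trans (sym (*-assoc α η (p + q))) (trans (cong (_* (p + q)) (*-comm α η))
                        (trans (*-assoc η α (p + q)) (cong (η *_) (*-distribˡ-+ α p q))))
    at : Fin n → Fin n → ℕ
    at x v = χ A v * 𝟙 ⌊ x ≟ v ⌋
    per-edge : ∀ e → ∑[ v < n ] (χ A v * (χ Y e * endsAt e v)) ≡ χ Y e * (χ A (src G e) + χ A (tgt G e))
    per-edge e = begin
      ∑[ v < n ] (χ A v * (χ Y e * endsAt e v))
        ≡⟨ sum-cong-≗ (λ v → regroup (χ A v) (χ Y e) _ _) ⟩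
      ∑[ v < n ] (χ Y e * (at (src G e) v + at (tgt G e) v))
        ≡⟨ sym (*-distribˡ-sum (χ Y e) (λ v → at (src G e) v + at (tgt G e) v)) ⟩
      χ Y e * ∑[ v < n ] (at (src G e) v + at (tgt G e) v)
        ≡⟨ cong (χ Y e *_) (∑-distrib-+ (at (src G e)) (at (tgt G e))) ⟩
      χ Y e * (∑[ v < n ] at (src G e) v + ∑[ v < n ] at (tgt G e) v)
        ≡⟨ cong (χ Y e *_) (cong₂ _+_ (∑-point (χ A) (src G e)) (∑-point (χ A) (tgt G e))) ⟩
      χ Y e * (χ A (src G e) + χ A (tgt G e))
        ∎

  ∑-degree≡∣δ∣+∣edgesIn∣ : ∀ A → ∑[ v < n ] (χ A v * degree G v) ≡ ∣ δ G A ∣ + ∣ edgesIn A ∣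
  ∑-degree≡∣δ∣+∣edgesIn∣ A = begin
    ∑[ v < n ] (χ A v * degree G v)                    ≡⟨ sum-cong-≗ (λ v → cong (χ A v *_) (degree≡degreeIn⊤ v)) ⟩
    ∑[ v < n ] (χ A v * degreeIn ⊤ v)                  ≡⟨ handshake A ⊤ ⟩
    ∑[ e < m ] (χ ⊤ e * (χ A (src G e) + χ A (tgt G e))) ≡⟨ sum-cong-≗ split ⟩
    ∑[ e < m ] (χ (δ G A) e + χ (edgesIn A) e)         ≡⟨ ∑-distrib-+ (χ (δ G A)) (χ (edgesIn A)) ⟩
    ∑[ e < m ] χ (δ G A) e + ∑[ e < m ] χ (edgesIn A) e ≡⟨ sym (cong₂ _+_ (∣p∣≡∑ (δ G A)) (∣p∣≡∑ (edgesIn A))) ⟩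
    ∣ δ G A ∣ + ∣ edgesIn A ∣                          ∎
    where
    open ≡-Reasoning
    𝟙+𝟙≡𝟙∨+𝟙∧ : ∀ a b → 𝟙 a + 𝟙 b ≡ 𝟙 (a ∨ b) + 𝟙 (a ∧ b)
    𝟙+𝟙≡𝟙∨+𝟙∧ true  true  = refl
    𝟙+𝟙≡𝟙∨+𝟙∧ true  false = refl
    𝟙+𝟙≡𝟙∨+𝟙∧ false true  = refl
    𝟙+𝟙≡𝟙∨+𝟙∧ false false = refl
    split : ∀ e → χ ⊤ e * (χ A (src G e) + χ A (tgt G e)) ≡ χ (δ G A) e + χ (edgesIn A) e
    split e rewrite lookup-replicate e true | lookup-δ A e | lookup-edgesIn A e =
      trans (+-identityʳ _) (𝟙+𝟙≡𝟙∨+𝟙∧ (lookup A (src G e)) (lookup A (tgt G e)))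

  trivalent⇒∣δ∣+∣edgesIn∣ : Trivalent G → ∀ A → ∣ δ G A ∣ + ∣ edgesIn A ∣ ≡ 3 * ∣ A ∣
  trivalent⇒∣δ∣+∣edgesIn∣ trivalent A = begin
    ∣ δ G A ∣ + ∣ edgesIn A ∣          ≡⟨ sym (∑-degree≡∣δ∣+∣edgesIn∣ A) ⟩
    ∑[ v < n ] (χ A v * degree G v)    ≡⟨ sum-cong-≗ (λ v → cong (χ A v *_) (trivalent v)) ⟩
    ∑[ v < n ] (χ A v * 3)             ≡⟨ sym (*-distribʳ-sum 3 (χ A)) ⟩
    ∑[ v < n ] χ A v * 3               ≡⟨ cong (_* 3) (sym (∣p∣≡∑ A)) ⟩
    ∣ A ∣ * 3                          ≡⟨ *-comm ∣ A ∣ 3 ⟩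
    3 * ∣ A ∣                          ∎
    where open ≡-Reasoning

  ∑-degreeIn-edgesIn : ∀ A → ∑[ v < n ] (χ A v * degreeIn (edgesIn A) v) ≡ 2 * ∣ edgesIn A ∣
  ∑-degreeIn-edgesIn A = begin
    ∑[ v < n ] (χ A v * degreeIn (edgesIn A) v)                  ≡⟨ handshake A (edgesIn A) ⟩
    ∑[ e < m ] (χ (edgesIn A) e * (χ A (src G e) + χ A (tgt G e))) ≡⟨ sum-cong-≗ both-ends ⟩
    ∑[ e < m ] (2 * χ (edgesIn A) e)                             ≡⟨ sym (*-distribˡ-sum 2 (χ (edgesIn A))) ⟩
    2 * ∑[ e < m ] χ (edgesIn A) e                               ≡⟨ cong (2 *_) (sym (∣p∣≡∑ (edgesIn A))) ⟩
    2 * ∣ edgesIn A ∣                                            ∎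
    where
    open ≡-Reasoning
    both-ends : ∀ e → χ (edgesIn A) e * (χ A (src G e) + χ A (tgt G e)) ≡ 2 * χ (edgesIn A) e
    both-ends e rewrite lookup-edgesIn A e with lookup A (src G e) | lookup A (tgt G e)
    ... | true  | true  = refl
    ... | true  | false = refl
    ... | false | _     = refl

-- The rank function r*(δ A)

module _ (G : Graph) where
  open Graph G

  rank*δ : Subset n → ℕ
  rank*δ A = rank* G (δ G A)

  δ-mono : ∀ {A A′} → A ⊆ A′ → δ G A ⊆ δ G A′
  δ-mono A⊆A′ e∈ = ∈δ⁺ G (Data.Sum.map A⊆A′ A⊆A′ (∈δ⁻ G e∈))

  δ-∪⊆ : ∀ A A′ → δ G (A ∪ A′) ⊆ δ G A ∪ δ G A′
  δ-∪⊆ A A′ e∈ with ∈δ⁻ G e∈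
  ... | inj₁ s∈ = [ p⊆p∪q _ ∘ ∈δ⁺ G ∘ inj₁ , q⊆p∪q _ _ ∘ ∈δ⁺ G ∘ inj₁ ]′ (x∈p∪q⁻ A A′ s∈)
  ... | inj₂ t∈ = [ p⊆p∪q _ ∘ ∈δ⁺ G ∘ inj₂ , q⊆p∪q _ _ ∘ ∈δ⁺ G ∘ inj₂ ]′ (x∈p∪q⁻ A A′ t∈)

  module _ (connected : Connected G) where

    rank*δ-mono : ∀ {A A′} → A ⊆ A′ → rank*δ A ≤ rank*δ A′
    rank*δ-mono = rank*-mono G connected ∘ δ-mono

    rank*δ-submodular : ∀ A A′ → rank*δ (A ∪ A′) + rank*δ (A ∩ A′) ≤ rank*δ A + rank*δ A′
    rank*δ-submodular A A′ = begin
      rank*δ (A ∪ A′) + rank*δ (A ∩ A′)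
        ≤⟨ +-mono-≤ (rank*-mono G connected (δ-∪⊆ A A′)) (rank*-mono G connected δ∩⊆) ⟩
      rank* G (δ G A ∪ δ G A′) + rank* G (δ G A ∩ δ G A′)
        ≤⟨ rank*-submodular G connected (δ G A) (δ G A′) ⟩
      rank*δ A + rank*δ A′
        ∎
      where
      open ≤-Reasoning
      δ∩⊆ : δ G (A ∩ A′) ⊆ δ G A ∩ δ G A′
      δ∩⊆ e∈ = x∈p∩q⁺ (δ-mono {A ∩ A′} (p∩q⊆p A A′) e∈ , δ-mono {A ∩ A′} (p∩q⊆q A A′) e∈)

    rank*δ+∣A∣+ω : ∀ A → rank*δ A + (∣ A ∣ + ω G (∁ A)) ≡ ∣ δ G A ∣ + 1
    rank*δ+∣A∣+ω A = trans (cong (rank*δ A +_) (sym (c-∁δ G))) (rank*+c G connected (δ G A))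

  -- Each component of G[V - Y] sends at least two edges to Y, and these edge sets are disjoint.
  module _ (2ec : TwoEdgeConnected G) {Y : Subset n} {y : Fin n} (y∈Y : y ∈ Y) where

    private
      inComponent : Fin n → Fin n → Bool
      inComponent r = conn G (∁ Y) ⊤ r

      boundary : Fin n → Subset m
      boundary r = tabulate (λ e → inComponent r (src G e) xor inComponent r (tgt G e))

      exits : ∀ {r e x z} → Link G e x z → Path G (∁ Y) ⊤ r x → inComponent r z ≡ false → z ∈ Y
      exits {z = z} l p z∉K with z ∈? Y
      ... | yes z∈Y = z∈Y
      ... | no z∉Y  = contradiction (trans (sym (Path⇒conn G (extend p ∈⊤ l (x∉p⇒x∈∁p z∉Y)))) z∉K) true≢false

      leaving : ∀ {r e} → e ∈ boundary r → ∃₂ λ x z → Link G e x z × Path G (∁ Y) ⊤ r x × z ∈ Y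
      leaving {r} {e} e∈ with xor-true (∈-tabulate⁻ e∈)
      ... | inj₁ (s∈K , t∉K) = _ , _ , forward  , conn⇒Path G s∈K , exits forward  (conn⇒Path G s∈K) t∉K
      ... | inj₂ (s∉K , t∈K) = _ , _ , backward , conn⇒Path G t∈K , exits backward (conn⇒Path G t∈K) s∉K

      boundary⊆ : ∀ r → boundary r ⊆ δ G Y ─ edgesIn G Y
      boundary⊆ r e∈ with leaving e∈
      ... | x , z , l , r→x , z∈Y = x∈p∧x∉q⇒x∈p─q (Link-∈δ G l (inj₂ z∈Y))
        (λ e∈E → x∈∁p⇒x∉p (Path-end G r→x) (Link-inside l (∈edgesIn⁻ G Y e∈E)))
        where
        Link-inside : ∀ {e x z} → Link G e x z → src G e ∈ Y × tgt G e ∈ Y → x ∈ Y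
        Link-inside forward  = proj₁
        Link-inside backward = proj₂

      boundaries-disjoint : ∀ {r r′ e} → r ∈ reps G (∁ Y) ⊤ → r′ ∈ reps G (∁ Y) ⊤ →
                            e ∈ boundary r → e ∈ boundary r′ → r ≡ r′
      boundaries-disjoint r∈ r′∈ e∈ e∈′ with leaving e∈ | leaving e∈′
      ... | _ , _ , forward  , r→x , _ | _ , _ , forward  , r′→x , _ =
        rep-unique G r∈ r′∈ (Path-trans G r→x (Path-sym G r′→x))
      ... | _ , _ , backward , r→x , _ | _ , _ , backward , r′→x , _ =
        rep-unique G r∈ r′∈ (Path-trans G r→x (Path-sym G r′→x))
      ... | _ , _ , forward  , r→x , _ | _ , _ , backward , _ , s∈Y =
        contradiction s∈Y (x∈∁p⇒x∉p (Path-end G r→x))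
      ... | _ , _ , backward , r→x , _ | _ , _ , forward  , _ , t∈Y =
        contradiction t∈Y (x∈∁p⇒x∉p (Path-end G r→x))

      outside-boundary : ∀ {r e} → e ∉ boundary r → inComponent r (src G e) ≡ inComponent r (tgt G e)
      outside-boundary {r} {e} e∉ with inComponent r (src G e) xor inComponent r (tgt G e) in crosses
      ... | true  = contradiction (∈-tabulate⁺ crosses) e∉
      ... | false = xor-false crosses

      -- A connected spanning edge set avoiding the boundary of the component of r would trap y in it.
      trapped : ∀ {r Z} → r ∈ ∁ Y → c G Z ≡ 1 → (∀ {e} → e ∈ Z → e ∉ boundary r) → Data.Empty.⊥
      trapped {r} {Z} r∈∁Y cZ≡1 avoids = x∈∁p⇒x∉p (Path-end G (conn⇒Path G y∈K)) y∈Y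
        where
        stays : ∀ {x w e} → e ∈ Z → Link G e x w → w ∈ ⊤ → inComponent r x ≡ true → inComponent r w ≡ true
        stays e∈Z forward  _ x∈K = trans (sym (outside-boundary (avoids e∈Z))) x∈K
        stays e∈Z backward _ x∈K = trans (outside-boundary (avoids e∈Z)) x∈K
        y∈K : inComponent r y ≡ true
        y∈K = Path-invariant G (λ x → inComponent r x ≡ true) stays
                (comps≡1⇒Path G cZ≡1 ∈⊤ ∈⊤) (Path⇒conn G (start r∈∁Y))

      two-exits : ∀ {r} → r ∈ reps G (∁ Y) ⊤ → 2 ≤ ∣ boundary r ∣
      two-exits {r} r∈ with nonempty? (boundary r)
      ... | no ¬ne = Data.Empty.⊥-elim (trapped (proj₁ (∈reps⁻ G r∈)) (proj₁ 2ec) (λ {e} _ e∈ → ¬ne (e , e∈)))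
      ... | yes (f , f∈) with 2 ≤? ∣ boundary r ∣
      ...   | yes 2≤ = 2≤
      ...   | no 2≰  = Data.Empty.⊥-elim (trapped (proj₁ (∈reps⁻ G r∈)) (proj₂ 2ec f)
                         (λ {e} e∈⊤-f e∈ → 2≰ (two-elements⇒∣p∣≥2 e∈ f∈ (λ { refl → x∈p─q⇒x∉q e∈⊤-f (x∈⁅x⁆ f) }))))

    2ω+e≤∣δ∣ : 2 * ω G (∁ Y) + ∣ edgesIn G Y ∣ ≤ ∣ δ G Y ∣
    2ω+e≤∣δ∣ = begin
      2 * ω G (∁ Y) + e           ≡⟨ cong (λ k → 2 * k + e) (comps≡∣reps∣ G (∁ Y) ⊤) ⟩
      2 * ∣ reps G (∁ Y) ⊤ ∣ + e  ≤⟨ +-monoˡ-≤ e (double-counting (reps G (∁ Y) ⊤) _ boundary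
                                                   two-exits (λ _ → boundary⊆ _) boundaries-disjoint) ⟩
      ∣ δ G Y ─ edgesIn G Y ∣ + e ≡⟨ +-comm (∣ δ G Y ─ edgesIn G Y ∣) e ⟩
      e + ∣ δ G Y ─ edgesIn G Y ∣ ≡⟨ sym (q⊆p⇒∣p∣≡∣q∣+∣p─q∣ (edgesIn⊆δ G Y)) ⟩
      ∣ δ G Y ∣                   ∎
      where
      open ≤-Reasoning
      e = ∣ edgesIn G Y ∣

  module _ (trivalent : Trivalent G) (connected : Connected G) where

    rank*δ-formula : ∀ A → rank*δ A + ω G (∁ A) + ∣ edgesIn G A ∣ ≡ 2 * ∣ A ∣ + 1
    rank*δ-formula A = +-cancelʳ-≡ a _ _ (begin
      r + w + e + a       ≡⟨ regroup₁ r w e a ⟩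
      r + (a + w) + e     ≡⟨ cong (_+ e) (rank*δ+∣A∣+ω connected A) ⟩
      d + 1 + e           ≡⟨ xy∙z≈xz∙y d 1 e ⟩
      d + e + 1           ≡⟨ cong (_+ 1) (trivalent⇒∣δ∣+∣edgesIn∣ G trivalent A) ⟩
      3 * a + 1           ≡⟨ regroup₂ a ⟩
      2 * a + 1 + a       ∎)
      where
      open ≡-Reasoning
      r = rank*δ A
      w = ω G (∁ A)
      a = ∣ A ∣
      e = ∣ edgesIn G A ∣
      d = ∣ δ G A ∣
      regroup₁ : ∀ r w e a → r + w + e + a ≡ r + (a + w) + e
      regroup₁ = solve-∀
      regroup₂ : ∀ a → 3 * a + 1 ≡ 2 * a + 1 + a
      regroup₂ = solve-∀

    rank*δ⊤+rank*δ⊤≡n+2 : rank*δ ⊤ + rank*δ ⊤ ≡ n + 2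
    rank*δ⊤+rank*δ⊤≡n+2 = +-cancelʳ-≡ (e + e) _ _ (begin
      r + r + (e + e)           ≡⟨ interchange r r e e ⟩
      (r + e) + (r + e)         ≡⟨ cong₂ _+_ r+e≡2n+1 r+e≡2n+1 ⟩
      (2 * n + 1) + (2 * n + 1) ≡⟨ regroup n ⟩
      n + 2 + 3 * n             ≡⟨ cong (n + 2 +_) (sym e+e≡3n) ⟩
      n + 2 + (e + e)           ∎)
      where
      open ≡-Reasoning
      r = rank*δ ⊤
      e = ∣ edgesIn G ⊤ ∣
      E⊤≡δ⊤ : edgesIn G ⊤ ≡ δ G ⊤
      E⊤≡δ⊤ = ⊆-antisym (λ _ → ∈δ⁺ G (inj₁ ∈⊤)) (λ _ → ∈edgesIn⁺ G ∈⊤ ∈⊤)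
      e+e≡3n : e + e ≡ 3 * n
      e+e≡3n = begin
        e + e                   ≡⟨ cong (λ X → ∣ X ∣ + e) E⊤≡δ⊤ ⟩
        ∣ δ G ⊤ ∣ + e           ≡⟨ trivalent⇒∣δ∣+∣edgesIn∣ G trivalent ⊤ ⟩
        3 * ∣ ⊤ {n} ∣           ≡⟨ cong (3 *_) (∣⊤∣≡n n) ⟩
        3 * n                   ∎
      ω∅≡0 : ω G (∁ ⊤) ≡ 0
      ω∅≡0 = trans (cong (ω G) (Empty-unique (λ (v , v∈) → x∈∁p⇒x∉p v∈ ∈⊤))) (comps⊥≡0 G ⊤)
      r+e≡2n+1 : r + e ≡ 2 * n + 1
      r+e≡2n+1 = begin
        r + e                   ≡⟨ cong (_+ e) (sym (trans (cong (r +_) ω∅≡0) (+-identityʳ r))) ⟩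
        r + ω G (∁ ⊤) + e       ≡⟨ rank*δ-formula ⊤ ⟩
        2 * ∣ ⊤ {n} ∣ + 1       ≡⟨ cong (λ k → 2 * k + 1) (∣⊤∣≡n n) ⟩
        2 * n + 1               ∎
      regroup : ∀ n → (2 * n + 1) + (2 * n + 1) ≡ n + 2 + 3 * n
      regroup = solve-∀

    rank*δ-large : TwoEdgeConnected G → ∀ {Y} → Nonempty Y → ∣ Y ∣ + 2 ≤ rank*δ Y + rank*δ Y
    rank*δ-large 2ec {Y} (y , y∈Y) = +-cancelʳ-≤ (2 * w + 2 * e) _ _ (begin
      a + 2 + (2 * w + 2 * e)       ≤⟨ +-monoʳ-≤ (a + 2) 2w+2e≤3a ⟩
      a + 2 + 3 * a                 ≡⟨ regroup₁ a ⟩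
      (2 * a + 1) + (2 * a + 1)     ≡⟨ sym (cong₂ _+_ (rank*δ-formula Y) (rank*δ-formula Y)) ⟩
      (r + w + e) + (r + w + e)     ≡⟨ regroup₂ r w e ⟩
      r + r + (2 * w + 2 * e)       ∎)
      where
      open ≤-Reasoning
      r = rank*δ Y
      w = ω G (∁ Y)
      a = ∣ Y ∣
      e = ∣ edgesIn G Y ∣
      regroup₁ : ∀ a → a + 2 + 3 * a ≡ (2 * a + 1) + (2 * a + 1)
      regroup₁ = solve-∀
      regroup₂ : ∀ r w e → (r + w + e) + (r + w + e) ≡ r + r + (2 * w + 2 * e)
      regroup₂ = solve-∀
      regroup₃ : ∀ w e → 2 * w + 2 * e ≡ 2 * w + e + e
      regroup₃ = solve-∀
      2w+2e≤3a : 2 * w + 2 * e ≤ 3 * a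
      2w+2e≤3a = begin
        2 * w + 2 * e               ≡⟨ regroup₃ w e ⟩
        2 * w + e + e               ≤⟨ +-monoˡ-≤ e (2ω+e≤∣δ∣ 2ec y∈Y) ⟩
        ∣ δ G Y ∣ + e               ≡⟨ trivalent⇒∣δ∣+∣edgesIn∣ G trivalent Y ⟩
        3 * a                       ∎

-- Submodular functions

module _ {k} (h : Subset k → ℕ) where

  -- Independence in the matroid induced by h - 1.
  Free : Subset k → Set
  Free B = ∀ {A} → A ⊆ B → Nonempty A → suc ∣ A ∣ ≤ h A

  Spans : Subset k → Subset k → Set
  Spans B W = ∀ {w} → w ∈ W → ∃ λ A → A ⊆ B × h (A ∪ ⁅ w ⁆) ≤ suc ∣ A ∣

module SubmodularBound {k} (h : Subset k → ℕ)
  (h-mono : ∀ {A A′} → A ⊆ A′ → h A ≤ h A′)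
  (h-submodular : ∀ A A′ → h (A ∪ A′) + h (A ∩ A′) ≤ h A + h A′)
  (h-large : ∀ {Y} → Nonempty Y → ∣ Y ∣ + 2 ≤ h Y + h Y)
  where

  Free-⊆ : ∀ {B B′} → B′ ⊆ B → Free h B → Free h B′
  Free-⊆ B′⊆B free A⊆B′ = free (B′⊆B ∘ A⊆B′)

  closure-bound : ∀ P T → (∀ {x} → x ∈ T → h (P ∪ ⁅ x ⁆) ≤ h P) → h (P ∪ T) ≤ h P
  closure-bound P = subset-induction Closed⇒bounded (λ _ → ≤-reflexive (cong h (∪-identityʳ P))) step
    where
    Closed⇒bounded : Subset k → Set
    Closed⇒bounded T = (∀ {x} → x ∈ T → h (P ∪ ⁅ x ⁆) ≤ h P) → h (P ∪ T) ≤ h P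
    step : ∀ {T x} → x ∉ T → Closed⇒bounded T → Closed⇒bounded (T ∪ ⁅ x ⁆)
    step {T} {x} _ IH closed = +-cancelʳ-≤ (h P) _ _ (begin
      h (P ∪ (T ∪ ⁅ x ⁆)) + h P                    ≤⟨ +-mono-≤ (h-mono ∪⊆) (h-mono P⊆∩) ⟩
      h (X ∪ Y) + h (X ∩ Y)                        ≤⟨ h-submodular X Y ⟩
      h X + h Y                                    ≤⟨ +-mono-≤ (IH (closed ∘ p⊆p∪q ⁅ x ⁆))
                                                                (closed (q⊆p∪q T ⁅ x ⁆ (x∈⁅x⁆ x))) ⟩
      h P + h P                                    ∎)
      where
      open ≤-Reasoning
      X = P ∪ T
      Y = P ∪ ⁅ x ⁆
      ∪⊆ : P ∪ (T ∪ ⁅ x ⁆) ⊆ X ∪ Y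
      ∪⊆ y∈ with x∈p∪q⁻ P (T ∪ ⁅ x ⁆) y∈
      ... | inj₁ y∈P = p⊆p∪q Y (p⊆p∪q T y∈P)
      ... | inj₂ y∈T∪x with x∈p∪q⁻ T ⁅ x ⁆ y∈T∪x
      ...   | inj₁ y∈T = p⊆p∪q Y (q⊆p∪q P T y∈T)
      ...   | inj₂ y∈x = q⊆p∪q X Y (q⊆p∪q P ⁅ x ⁆ y∈x)
      P⊆∩ : P ⊆ X ∩ Y
      P⊆∩ y∈P = x∈p∩q⁺ (p⊆p∪q T y∈P , p⊆p∪q ⁅ x ⁆ y∈P)

  spanning-set-nonempty : ∀ {A w} → h (A ∪ ⁅ w ⁆) ≤ suc ∣ A ∣ → Nonempty A
  spanning-set-nonempty {A} {w} h≤ with nonempty? A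
  ... | yes ne = ne
  ... | no ¬ne = contradiction (begin
      3                                  ≤⟨ +-monoˡ-≤ 2 (Nonempty⇒∣p∣>0 A∪w≠∅) ⟩
      ∣ A ∪ ⁅ w ⁆ ∣ + 2                  ≤⟨ h-large A∪w≠∅ ⟩
      h (A ∪ ⁅ w ⁆) + h (A ∪ ⁅ w ⁆)      ≤⟨ +-mono-≤ h≤ h≤ ⟩
      suc ∣ A ∣ + suc ∣ A ∣              ≡⟨ cong (λ a → suc a + suc a) (Empty⇒∣p∣≡0 ¬ne) ⟩
      2                                  ∎) (λ { (s≤s (s≤s ())) })
    where
    open ≤-Reasoning
    A∪w≠∅ : Nonempty (A ∪ ⁅ w ⁆)
    A∪w≠∅ = w , q⊆p∪q A ⁅ w ⁆ (x∈⁅x⁆ w)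

  module _ {B : Subset k} (free : Free h B) where

    Tight : Subset k → Set
    Tight T = T ⊆ B × Nonempty T × h T ≤ suc ∣ T ∣

    tight? : ∀ T → Dec (Tight T)
    tight? T = (T ⊆? B) ×-dec nonempty? T ×-dec (h T ≤? suc ∣ T ∣)

    -- Intersecting tight sets have a tight union, so a tight set of maximum size absorbs every circuit it meets.
    absorbed : ∀ {P A w} → Tight P → (∀ {T} → Tight T → ∣ T ∣ ≤ ∣ P ∣) → A ⊆ B →
               h (A ∪ ⁅ w ⁆) ≤ suc ∣ A ∣ → Nonempty (A ∩ P) → h (P ∪ ⁅ w ⁆) ≤ h P
    absorbed {P} {A} {w} (P⊆B , P≠∅ , hP≤) maximum A⊆B hA+w≤ (x , x∈A∩P) = +-cancelʳ-≤ (h A) _ _ (begin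
      h (P ∪ ⁅ w ⁆) + h A                        ≤⟨ +-mono-≤ (h-mono P∪w⊆) (h-mono A⊆P∩) ⟩
      h (P ∪ (A ∪ ⁅ w ⁆)) + h (P ∩ (A ∪ ⁅ w ⁆))  ≤⟨ h-submodular P (A ∪ ⁅ w ⁆) ⟩
      h P + h (A ∪ ⁅ w ⁆)                        ≤⟨ +-monoʳ-≤ (h P) (≤-trans hA+w≤ (free A⊆B (x , x∈A))) ⟩
      h P + h A                                  ∎)
      where
      open ≤-Reasoning
      x∈A = proj₁ (x∈p∩q⁻ A P x∈A∩P)
      x∈P = proj₂ (x∈p∩q⁻ A P x∈A∩P)
      hA≤ : h A ≤ suc ∣ A ∣
      hA≤ = ≤-trans (h-mono (p⊆p∪q ⁅ w ⁆)) hA+w≤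
      P∪A-tight : Tight (P ∪ A)
      P∪A-tight = (λ y∈ → [ P⊆B , A⊆B ]′ (x∈p∪q⁻ P A y∈)) , (x , p⊆p∪q A x∈P) ,
        +-cancelʳ-≤ (h (P ∩ A)) _ _ (begin
          h (P ∪ A) + h (P ∩ A)             ≤⟨ h-submodular P A ⟩
          h P + h A                         ≤⟨ +-mono-≤ hP≤ hA≤ ⟩
          suc ∣ P ∣ + suc ∣ A ∣             ≡⟨ cong suc (+-suc ∣ P ∣ ∣ A ∣) ⟩
          suc (suc (∣ P ∣ + ∣ A ∣))         ≡⟨ cong (λ k → suc (suc k)) (sym (∣p∪q∣+∣p∩q∣≡∣p∣+∣q∣ P A)) ⟩
          suc (suc (∣ P ∪ A ∣ + ∣ P ∩ A ∣)) ≡⟨ cong suc (sym (+-suc ∣ P ∪ A ∣ ∣ P ∩ A ∣)) ⟩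
          suc ∣ P ∪ A ∣ + suc ∣ P ∩ A ∣     ≤⟨ +-monoʳ-≤ (suc ∣ P ∪ A ∣)
                                                          (free (P⊆B ∘ p∩q⊆p P A) (x , x∈p∩q⁺ (x∈P , x∈A))) ⟩
          suc ∣ P ∪ A ∣ + h (P ∩ A)         ∎)
      A⊆P : A ⊆ P
      A⊆P = p⊆q∧∣q∣≤∣p∣⇒q⊆p (p⊆p∪q A) (maximum P∪A-tight) ∘ q⊆p∪q P A
      P∪w⊆ : P ∪ ⁅ w ⁆ ⊆ P ∪ (A ∪ ⁅ w ⁆)
      P∪w⊆ y∈ = [ p⊆p∪q _ , q⊆p∪q P _ ∘ q⊆p∪q A ⁅ w ⁆ ]′ (x∈p∪q⁻ P ⁅ w ⁆ y∈)
      A⊆P∩ : A ⊆ P ∩ (A ∪ ⁅ w ⁆)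
      A⊆P∩ y∈A = x∈p∩q⁺ (A⊆P y∈A , p⊆p∪q ⁅ w ⁆ y∈A)

    record Peeling (W : Subset k) : Set where
      field
        P C        : Subset k
        P⊆B        : P ⊆ B
        P≠∅        : Nonempty P
        C⊆W        : C ⊆ W
        ∣C∣≤∣P∣    : ∣ C ∣ ≤ ∣ P ∣
        spans-rest : Spans h (B ─ P) (W ─ C)

    peel : ∀ {W w} → Spans h B W → W ⊆ ∁ B → w ∈ W → Peeling W
    peel {W} {w} spans W⊆∁B w∈W with spans w∈W
    ... | A₀ , A₀⊆B , hA₀+w≤ with max-card tight? {X = A₀}
           (A₀⊆B , spanning-set-nonempty hA₀+w≤ , ≤-trans (h-mono (p⊆p∪q ⁅ w ⁆)) hA₀+w≤)
    ... | P , tight-P@(P⊆B , P≠∅ , hP≤) , maximum = record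
      { P = P ; C = C ; P⊆B = P⊆B ; P≠∅ = P≠∅ ; C⊆W = proj₁ ∘ ∈C⁻
      ; ∣C∣≤∣P∣ = ∣C∣≤∣P∣ ; spans-rest = spans′ }
      where
      C : Subset k
      C = tabulate (λ x → lookup W x ∧ ⌊ h (P ∪ ⁅ x ⁆) ≤? h P ⌋)
      ∈C⁻ : ∀ {x} → x ∈ C → x ∈ W × h (P ∪ ⁅ x ⁆) ≤ h P
      ∈C⁻ {x} x∈C with ∧-true (∈-tabulate⁻ x∈C)
      ... | x∈W , closes = lookup⇒[]= x W x∈W , ⌊⌋-true⁻ (h (P ∪ ⁅ x ⁆) ≤? h P) closes
      ∈C⁺ : ∀ {x} → x ∈ W → h (P ∪ ⁅ x ⁆) ≤ h P → x ∈ C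
      ∈C⁺ {x} x∈W closes =
        ∈-tabulate⁺ (cong₂ _∧_ ([]=⇒lookup x∈W) (⌊⌋-true⁺ (h (P ∪ ⁅ x ⁆) ≤? h P) closes))
      ∣C∣≤∣P∣ : ∣ C ∣ ≤ ∣ P ∣
      ∣C∣≤∣P∣ = +-cancelˡ-≤ (∣ P ∣) _ _ (+-cancelʳ-≤ 2 _ _ (begin
        ∣ P ∣ + ∣ C ∣ + 2              ≡⟨ cong (_+ 2) (sym (disjoint⇒∣p∪q∣≡∣p∣+∣q∣ P∩C≡∅)) ⟩
        ∣ P ∪ C ∣ + 2                  ≤⟨ h-large (proj₁ P≠∅ , p⊆p∪q C (proj₂ P≠∅)) ⟩
        h (P ∪ C) + h (P ∪ C)          ≤⟨ +-mono-≤ hP∪C≤ hP∪C≤ ⟩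
        suc ∣ P ∣ + suc ∣ P ∣          ≡⟨ trans (cong suc (+-suc ∣ P ∣ ∣ P ∣)) (+-comm 2 (∣ P ∣ + ∣ P ∣)) ⟩
        ∣ P ∣ + ∣ P ∣ + 2              ∎))
        where
        open ≤-Reasoning
        hP∪C≤ : h (P ∪ C) ≤ suc ∣ P ∣
        hP∪C≤ = ≤-trans (closure-bound P C (proj₂ ∘ ∈C⁻)) hP≤
        P∩C≡∅ : Empty (P ∩ C)
        P∩C≡∅ (x , x∈P∩C) with x∈p∩q⁻ P C x∈P∩C
        ... | x∈P , x∈C = x∈∁p⇒x∉p (W⊆∁B (proj₁ (∈C⁻ x∈C))) (P⊆B x∈P)
      spans′ : Spans h (B ─ P) (W ─ C)
      spans′ {x} x∈W─C with spans (p─q⊆p W C x∈W─C)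
      ... | A , A⊆B , hA+x≤ with nonempty? (A ∩ P)
      ...   | yes meets = contradiction (∈C⁺ (p─q⊆p W C x∈W─C) (absorbed tight-P maximum A⊆B hA+x≤ meets))
                                        (x∈p─q⇒x∉q x∈W─C)
      ...   | no misses =
        A , (λ y∈A → x∈p∧x∉q⇒x∈p─q (A⊆B y∈A) (λ y∈P → misses (_ , x∈p∩q⁺ (y∈A , y∈P)))) , hA+x≤

  private
    Bound : ℕ → Set
    Bound s = ∀ {B W} → ∣ B ∣ < s → Free h B → Spans h B W → W ⊆ ∁ B → ∣ W ∣ ≤ ∣ B ∣

    bound-step : ∀ {s} → Bound s → Bound (suc s)
    bound-step {s} IH {B} {W} ∣B∣<1+s free spans W⊆∁B with nonempty? W
    ... | no W≡∅ = ≤-trans (≤-reflexive (Empty⇒∣p∣≡0 W≡∅)) z≤n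
    ... | yes (w , w∈W) = combine (peel free spans W⊆∁B w∈W)
      where
      -- Taking `peel` apart by `with` instead would make Agda evaluate the search in `max-card`.
      combine : Peeling free W → ∣ W ∣ ≤ ∣ B ∣
      combine peeling = subst₂ _≤_ (sym (q⊆p⇒∣p∣≡∣q∣+∣p─q∣ C⊆W)) (sym (q⊆p⇒∣p∣≡∣q∣+∣p─q∣ P⊆B))
        (+-mono-≤ ∣C∣≤∣P∣ (IH ∣B─P∣<s (Free-⊆ (p─q⊆p B P) free) spans-rest
          (λ y∈W─C → x∉p⇒x∈∁p (x∈∁p⇒x∉p (W⊆∁B (p─q⊆p W C y∈W─C)) ∘ p─q⊆p B P))))
        where
        open Peeling peeling
        ∣B─P∣<s : ∣ B ─ P ∣ < s
        ∣B─P∣<s = ≤-trans (p∩q≢∅⇒∣p─q∣<∣p∣ B P (proj₁ P≠∅ , x∈p∩q⁺ (P⊆B (proj₂ P≠∅) , proj₂ P≠∅)))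
                          (≤-pred ∣B∣<1+s)

    bound : ∀ s → Bound s
    bound zero    ()
    bound (suc s) = bound-step (bound s)

  free-spanning-bound : ∀ {B W} → Free h B → Spans h B W → W ⊆ ∁ B → ∣ W ∣ ≤ ∣ B ∣
  free-spanning-bound {B} = bound (suc ∣ B ∣) ≤-refl

-- Forests

module _ (G : Graph) where
  open Graph G

  Sparse : Subset n → Set
  Sparse A = ∀ {A′} → A′ ⊆ A → Nonempty A′ → suc ∣ edgesIn G A′ ∣ ≤ ∣ A′ ∣

  leaf : ∀ {A} → Sparse A → Nonempty A → ∃ λ x → x ∈ A × degreeIn G (edgesIn G A) x ≤ 1
  leaf {A} sparse A≠∅ with any? (λ x → (x ∈? A) ×-dec (degreeIn G (edgesIn G A) x ≤? 1))
  ... | yes found = found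
  ... | no ¬found = contradiction (begin
      suc (∣ A ∣ * 2)                       ≤⟨ +-monoʳ-≤ 1 (∑-lower-bound deg branching) ⟩
      suc (∑[ v < n ] (χ A v * deg v))      ≡⟨ cong suc (∑-degreeIn-edgesIn G A) ⟩
      suc (2 * ∣ edgesIn G A ∣)             ≤⟨ n≤1+n _ ⟩
      2 + 2 * ∣ edgesIn G A ∣               ≡⟨ sym (*-suc 2 ∣ edgesIn G A ∣) ⟩
      2 * suc ∣ edgesIn G A ∣               ≤⟨ *-monoʳ-≤ 2 (sparse ⊆-refl A≠∅) ⟩
      2 * ∣ A ∣                             ≡⟨ *-comm 2 ∣ A ∣ ⟩
      ∣ A ∣ * 2                             ∎) (<-irrefl refl)
    where
    open ≤-Reasoning
    deg = degreeIn G (edgesIn G A)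
    branching : ∀ {v} → v ∈ A → 2 ≤ deg v
    branching v∈A = ≰⇒> (λ ≤1 → ¬found (_ , v∈A , ≤1))

  module _ {A : Subset n} {x : Fin n} (x∈A : x ∈ A) (deg≤1 : degreeIn G (edgesIn G A) x ≤ 1) where

    private
      E E′ I : Subset m
      E  = edgesIn G A
      E′ = edgesIn G (A - x)
      I  = E ─ E′

      E′⊆E : E′ ⊆ E
      E′⊆E e∈E′ with ∈edgesIn⁻ G (A - x) e∈E′
      ... | s∈ , t∈ = ∈edgesIn⁺ G (p─q⊆p A ⁅ x ⁆ s∈) (p─q⊆p A ⁅ x ⁆ t∈)

      at-x : ∀ {e} → e ∈ I → src G e ≡ x ⊎ tgt G e ≡ x
      at-x {e} e∈I with ∈edgesIn⁻ G A (p─q⊆p E E′ e∈I) | src G e ≟ x | tgt G e ≟ x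
      ... | _ | yes s≡x | _ = inj₁ s≡x
      ... | _ | no _ | yes t≡x = inj₂ t≡x
      ... | s∈A , t∈A | no s≢x | no t≢x =
        contradiction (∈edgesIn⁺ G (x∈p∧x≢y⇒x∈p-y s∈A s≢x) (x∈p∧x≢y⇒x∈p-y t∈A t≢x)) (x∈p─q⇒x∉q e∈I)

      contribution≤1 : ∀ e → χ E e * endsAt G e x ≤ 1
      contribution≤1 e = ≤-trans (∑-term≤ (λ e → χ E e * endsAt G e x) e) deg≤1

      no-loop : ∀ {e} → e ∈ E → src G e ≡ x → tgt G e ≡ x → Data.Empty.⊥
      no-loop {e} e∈E refl t≡x with contribution≤1 e
      ... | ≤1 rewrite []=⇒lookup e∈E | ⌊⌋-true⁺ (src G e ≟ src G e) refl
                     | ⌊⌋-true⁺ (tgt G e ≟ src G e) t≡x with ≤1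
      ... | s≤s ()

      ∣I∣≤1 : ∣ I ∣ ≤ 1
      ∣I∣≤1 = begin
        ∣ I ∣                              ≡⟨ ∣p∣≡∑ I ⟩
        ∑[ e < m ] χ I e                   ≤⟨ ∑-mono-≤ counted ⟩
        ∑[ e < m ] (χ E e * endsAt G e x)  ≤⟨ deg≤1 ⟩
        1                                  ∎
        where
        open ≤-Reasoning
        counted : ∀ e → χ I e ≤ χ E e * endsAt G e x
        counted e with lookup I e in e∈I
        ... | false = z≤n
        ... | true rewrite []=⇒lookup (p─q⊆p E E′ (lookup⇒[]= e I e∈I))
          with at-x (lookup⇒[]= e I e∈I)
        ...   | inj₁ s≡x rewrite ⌊⌋-true⁺ (src G e ≟ x) s≡x = s≤s z≤n
        ...   | inj₂ t≡x rewrite ⌊⌋-true⁺ (tgt G e ≟ x) t≡x = ≤-trans (m≤n+m 1 _) (m≤m+n _ 0)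

      isolated-x : ∀ {u v} → Path G ⊤ E′ u v → u ≡ x → v ≡ x
      isolated-x p u≡x = Path-invariant G (_≡ x) stays p u≡x
        where
        x∉A-x : x ∉ A - x
        x∉A-x x∈ = x∈p─q⇒x∉q x∈ (x∈⁅x⁆ x)
        stays : ∀ {z w e} → e ∈ E′ → Link G e z w → w ∈ ⊤ → z ≡ x → w ≡ x
        stays e∈E′ forward  _ refl = contradiction (proj₁ (∈edgesIn⁻ G (A - x) e∈E′)) x∉A-x
        stays e∈E′ backward _ refl = contradiction (proj₂ (∈edgesIn⁻ G (A - x) e∈E′)) x∉A-x

    prune-leaf : c G (edgesIn G (A - x)) + ∣ edgesIn G (A - x) ∣ ≡ c G (edgesIn G A) + ∣ edgesIn G A ∣
    prune-leaf with nonempty? I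
    ... | no I≡∅ = cong (λ Y → c G Y + ∣ Y ∣) (⊆-antisym E′⊆E E⊆E′)
      where
      E⊆E′ : E ⊆ E′
      E⊆E′ {e} e∈E with e ∈? E′
      ... | yes e∈E′ = e∈E′
      ... | no e∉E′  = contradiction (e , x∈p∧x∉q⇒x∈p─q e∈E e∉E′) I≡∅
    ... | yes (f , f∈I) = begin
      c G E′ + ∣ E′ ∣                   ≡⟨ cong (_+ ∣ E′ ∣) (c-join-separate G (∪⁅⁆-Joins G E′ f) f-joins) ⟩
      suc (c G (E′ ∪ ⁅ f ⁆)) + ∣ E′ ∣   ≡⟨ sym (+-suc _ _) ⟩
      c G (E′ ∪ ⁅ f ⁆) + suc ∣ E′ ∣     ≡⟨ cong (c G (E′ ∪ ⁅ f ⁆) +_) (sym (x∉p⇒∣p∪⁅x⁆∣≡1+∣p∣ f∉E′)) ⟩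
      c G (E′ ∪ ⁅ f ⁆) + ∣ E′ ∪ ⁅ f ⁆ ∣ ≡⟨ cong (λ Y → c G Y + ∣ Y ∣) E′∪f≡E ⟩
      c G E + ∣ E ∣                     ∎
      where
      open ≡-Reasoning
      f∈E : f ∈ E
      f∈E = p─q⊆p E E′ f∈I
      f∉E′ : f ∉ E′
      f∉E′ = x∈p─q⇒x∉q f∈I
      -- One end of f is x, which no edge of E′ touches, and f is not a loop.
      f-joins : ¬ Path G ⊤ E′ (src G f) (tgt G f)
      f-joins p with at-x f∈I
      ... | inj₁ s≡x = no-loop f∈E s≡x (isolated-x p s≡x)
      ... | inj₂ t≡x = no-loop f∈E (isolated-x (Path-sym G p) t≡x) t≡x
      E′∪f≡E : E′ ∪ ⁅ f ⁆ ≡ E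
      E′∪f≡E = ⊆-antisym ⊆E E⊆
        where
        ⊆E : E′ ∪ ⁅ f ⁆ ⊆ E
        ⊆E e∈ = [ E′⊆E , (λ e∈f → subst (_∈ E) (sym (x∈⁅y⁆⇒x≡y f e∈f)) f∈E) ]′ (x∈p∪q⁻ E′ ⁅ f ⁆ e∈)
        E⊆ : E ⊆ E′ ∪ ⁅ f ⁆
        E⊆ {e} e∈E with e ∈? E′ | e ≟ f
        ... | yes e∈E′ | _        = p⊆p∪q ⁅ f ⁆ e∈E′
        ... | no _     | yes refl = q⊆p∪q E′ ⁅ f ⁆ (x∈⁅x⁆ f)
        ... | no e∉E′  | no e≢f   =
          contradiction (two-elements⇒∣p∣≥2 (x∈p∧x∉q⇒x∈p─q e∈E e∉E′) f∈I e≢f) (<⇒≱ (s≤s ∣I∣≤1))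

  Sparse⇒c+e≡n : ∀ {A} → Sparse A → c G (edgesIn G A) + ∣ edgesIn G A ∣ ≡ n
  Sparse⇒c+e≡n {A} = go ∣ A ∣ ≤-refl
    where
    go : ∀ s {A} → ∣ A ∣ ≤ s → Sparse A → c G (edgesIn G A) + ∣ edgesIn G A ∣ ≡ n
    go s {A} ∣A∣≤s sparse with nonempty? A
    ... | no A≡∅ = begin
      c G (edgesIn G A) + ∣ edgesIn G A ∣ ≡⟨ cong (λ Y → c G Y + ∣ Y ∣) E≡⊥ ⟩
      c G ⊥ + ∣ ⊥ {m} ∣                   ≡⟨ cong₂ _+_ (c⊥≡n G) (∣⊥∣≡0 m) ⟩
      n + 0                               ≡⟨ +-identityʳ n ⟩
      n                                   ∎
      where
      open ≡-Reasoning
      E≡⊥ : edgesIn G A ≡ ⊥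
      E≡⊥ = Empty-unique (λ (e , e∈) → A≡∅ (_ , proj₁ (∈edgesIn⁻ G A e∈)))
    ... | yes A≠∅ with leaf sparse A≠∅ | s
    ...   | x , x∈A , deg≤1 | zero  = contradiction (≤-trans (Nonempty⇒∣p∣>0 A≠∅) ∣A∣≤s) λ ()
    ...   | x , x∈A , deg≤1 | suc s = trans (sym (prune-leaf x∈A deg≤1))
            (go s (≤-pred (≤-trans (x∈p⇒∣p-x∣<∣p∣ x∈A) ∣A∣≤s)) (λ A′⊆A-x → sparse (p─q⊆p A ⁅ x ⁆ ∘ A′⊆A-x)))

-- Bases of the graph curve matroid

module _ (G : Graph) where
  open Graph G

  dependent? : ∀ A → Dec (Dep G A)
  dependent? A = nonempty? A ×-dec (rank*δ G A ≤? ∣ A ∣)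

  dependent⇒circuit : ∀ {A} → Dep G A → ∃ λ C → C ⊆ A × Circuit G C
  dependent⇒circuit dep with minimal-⊆ dependent? dep
  ... | C , C⊆A , depC , minimal = C , C⊆A , depC , (λ _ → minimal)

  independent⇒free : ∀ {B} → Independent G B → Free (rank*δ G) B
  independent⇒free {B} independent {A} A⊆B A≠∅ with suc ∣ A ∣ ≤? rank*δ G A
  ... | yes free = free
  ... | no ¬free with dependent⇒circuit (A≠∅ , ≤-pred (≰⇒> ¬free))
  ...   | C , C⊆A , circuit = Data.Empty.⊥-elim (independent C (A⊆B ∘ C⊆A) circuit)

  -- Adding w ∉ B to a basis creates a circuit C ∋ w, and C - w witnesses that B spans w.
  basis⇒spans : ∀ {B} → Basis G B → Spans (rank*δ G) B (∁ B)
  basis⇒spans {B} (independent , maximal) {w} w∈∁B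
    with anySubset? (λ A → (A ⊆? B) ×-dec (rank*δ G (A ∪ ⁅ w ⁆) ≤? suc ∣ A ∣))
  ... | yes (A , A⊆B , spanned) = A , A⊆B , spanned
  ... | no none = contradiction (maximal (B ∪ ⁅ w ⁆) (p⊆p∪q ⁅ w ⁆) independent′ (q⊆p∪q B ⁅ w ⁆ (x∈⁅x⁆ w)))
                                (x∈∁p⇒x∉p w∈∁B)
    where
    independent′ : Independent G (B ∪ ⁅ w ⁆)
    independent′ C C⊆ circuit with w ∈? C
    ... | no w∉C = independent C C⊆B circuit
      where
      C⊆B : C ⊆ B
      C⊆B {y} y∈C with x∈p∪q⁻ B ⁅ w ⁆ (C⊆ y∈C)
      ... | inj₁ y∈B = y∈B
      ... | inj₂ y∈w = contradiction (subst (_∈ C) (x∈⁅y⁆⇒x≡y w y∈w) y∈C) w∉C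
    ... | yes w∈C = none (C - w , C-w⊆B , spanned)
      where
      C-w⊆B : C - w ⊆ B
      C-w⊆B {y} y∈ with x∈p∪q⁻ B ⁅ w ⁆ (C⊆ (p─q⊆p C ⁅ w ⁆ y∈))
      ... | inj₁ y∈B = y∈B
      ... | inj₂ y∈w = contradiction y∈w (x∈p─q⇒x∉q y∈)
      spanned : rank*δ G ((C - w) ∪ ⁅ w ⁆) ≤ suc ∣ C - w ∣
      spanned = subst₂ (λ X k → rank*δ G X ≤ k) (sym (p-x∪⁅x⁆≡p w∈C)) (x∈p⇒∣p∣≡1+∣p-x∣ w∈C)
                       (proj₂ (proj₁ circuit))

module _ (G : Graph) (trivalent : Trivalent G) (2ec : TwoEdgeConnected G)
         {B : Subset (Graph.n G)} (basis : Basis G B) where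
  open Graph G

  private
    connected : Connected G
    connected = proj₁ 2ec

    free : Free (rank*δ G) B
    free = independent⇒free G (proj₁ basis)

    r = rank*δ G

    open SubmodularBound r (rank*δ-mono G connected) (rank*δ-submodular G connected)
                           (rank*δ-large G trivalent connected 2ec)

    half : ∀ {a b} → a + a ≤ b + b → a ≤ b
    half {a} {b} a+a≤b+b = ≮⇒≥ (λ b<a → <⇒≱ (+-mono-< b<a b<a) a+a≤b+b)

  ∣∁B∣≤∣B∣ : ∣ ∁ B ∣ ≤ ∣ B ∣
  ∣∁B∣≤∣B∣ = free-spanning-bound free (basis⇒spans G basis) ⊆-refl

  basis-nonempty : Nonempty B
  basis-nonempty = ∣p∣>0⇒Nonempty (≰⇒> λ ∣B∣≤0 → <⇒≱ 0<n (begin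
    n                  ≡⟨ sym (∣p∣+∣∁p∣≡k B) ⟩
    ∣ B ∣ + ∣ ∁ B ∣    ≤⟨ +-mono-≤ ∣B∣≤0 (≤-trans ∣∁B∣≤∣B∣ ∣B∣≤0) ⟩
    0                  ∎))
    where
    open ≤-Reasoning
    0<n : 0 < n
    0<n = subst (_≤ n) connected (comps≤n G ⊤ ⊤)

  -- Squeezed between suc ∣ B ∣ ≤ r B ≤ r ⊤ and r ⊤ + r ⊤ ≡ n + 2 ≡ ∣ B ∣ + ∣ ∁ B ∣ + 2 ≤ ∣ B ∣ + ∣ B ∣ + 2.
  basis-rank : r B ≡ suc ∣ B ∣ × ∣ B ∣ ≤ ∣ ∁ B ∣
  basis-rank = ≤-antisym (half (begin
      r B + r B              ≤⟨ +-mono-≤ rB≤r⊤ rB≤r⊤ ⟩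
      r ⊤ + r ⊤              ≡⟨ rank*δ⊤+rank*δ⊤≡n+2 G trivalent connected ⟩
      n + 2                  ≡⟨ cong (_+ 2) (sym (∣p∣+∣∁p∣≡k B)) ⟩
      ∣ B ∣ + ∣ ∁ B ∣ + 2    ≤⟨ +-monoˡ-≤ 2 (+-monoʳ-≤ ∣ B ∣ ∣∁B∣≤∣B∣) ⟩
      ∣ B ∣ + ∣ B ∣ + 2      ≡⟨ regroup ∣ B ∣ ⟩
      suc ∣ B ∣ + suc ∣ B ∣  ∎)) B-free ,
    +-cancelˡ-≤ ∣ B ∣ _ _ (+-cancelʳ-≤ 2 _ _ (begin
      ∣ B ∣ + ∣ B ∣ + 2       ≡⟨ regroup ∣ B ∣ ⟩
      suc ∣ B ∣ + suc ∣ B ∣   ≤⟨ +-mono-≤ (≤-trans B-free rB≤r⊤) (≤-trans B-free rB≤r⊤) ⟩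
      r ⊤ + r ⊤               ≡⟨ rank*δ⊤+rank*δ⊤≡n+2 G trivalent connected ⟩
      n + 2                   ≡⟨ cong (_+ 2) (sym (∣p∣+∣∁p∣≡k B)) ⟩
      ∣ B ∣ + ∣ ∁ B ∣ + 2     ∎))
    where
    open ≤-Reasoning
    B-free : suc ∣ B ∣ ≤ r B
    B-free = free ⊆-refl basis-nonempty
    rB≤r⊤ : r B ≤ r ⊤
    rB≤r⊤ = rank*δ-mono G connected {B} ⊆⊤
    regroup : ∀ b → b + b + 2 ≡ suc b + suc b
    regroup = solve-∀

  ω∁B+e≡∣B∣ : ω G (∁ B) + ∣ edgesIn G B ∣ ≡ ∣ B ∣
  ω∁B+e≡∣B∣ = +-cancelˡ-≡ (suc ∣ B ∣) _ _ (begin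
    suc ∣ B ∣ + (ω G (∁ B) + ∣ edgesIn G B ∣)   ≡⟨ sym (+-assoc (suc ∣ B ∣) _ _) ⟩
    suc ∣ B ∣ + ω G (∁ B) + ∣ edgesIn G B ∣     ≡⟨ cong (λ k → k + ω G (∁ B) + ∣ edgesIn G B ∣)
                                                        (sym (proj₁ basis-rank)) ⟩
    r B + ω G (∁ B) + ∣ edgesIn G B ∣           ≡⟨ rank*δ-formula G trivalent connected B ⟩
    2 * ∣ B ∣ + 1                               ≡⟨ regroup ∣ B ∣ ⟩
    suc ∣ B ∣ + ∣ B ∣                           ∎)
    where
    open ≡-Reasoning
    regroup : ∀ b → 2 * b + 1 ≡ suc b + b
    regroup = solve-∀

  basis-sparse : Sparse G B
  basis-sparse {A} A⊆B A≠∅ = +-cancelˡ-≤ (suc ∣ A ∣) _ _ (begin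
    suc ∣ A ∣ + suc ∣ edgesIn G A ∣             ≡⟨ regroup₁ ∣ A ∣ ∣ edgesIn G A ∣ ⟩
    suc ∣ A ∣ + 1 + ∣ edgesIn G A ∣             ≤⟨ +-monoˡ-≤ ∣ edgesIn G A ∣ (+-mono-≤ (free A⊆B A≠∅) ω∁A≥1) ⟩
    r A + ω G (∁ A) + ∣ edgesIn G A ∣           ≡⟨ rank*δ-formula G trivalent connected A ⟩
    2 * ∣ A ∣ + 1                               ≡⟨ regroup₂ ∣ A ∣ ⟩
    suc ∣ A ∣ + ∣ A ∣                           ∎)
    where
    open ≤-Reasoning
    ∁B≠∅ : Nonempty (∁ B)
    ∁B≠∅ = ∣p∣>0⇒Nonempty (≤-trans (Nonempty⇒∣p∣>0 basis-nonempty) (proj₂ basis-rank))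
    ω∁A≥1 : 1 ≤ ω G (∁ A)
    ω∁A≥1 = comps>0 G (proj₁ ∁B≠∅ , p⊆q⇒∁p⊇∁q A⊆B (proj₂ ∁B≠∅))
    regroup₁ : ∀ a e → suc a + suc e ≡ suc a + 1 + e
    regroup₁ = solve-∀
    regroup₂ : ∀ a → 2 * a + 1 ≡ suc a + a
    regroup₂ = solve-∀

  ωB+e≡∣B∣ : ω G B + ∣ edgesIn G B ∣ ≡ ∣ B ∣
  ωB+e≡∣B∣ = +-cancelˡ-≡ ∣ ∁ B ∣ _ _ (begin
    ∣ ∁ B ∣ + (ω G B + ∣ edgesIn G B ∣)          ≡⟨ sym (+-assoc ∣ ∁ B ∣ _ _) ⟩
    ∣ ∁ B ∣ + ω G B + ∣ edgesIn G B ∣            ≡⟨ cong (λ X → ∣ ∁ B ∣ + ω G X + ∣ edgesIn G B ∣)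
                                                         (sym (¬-involutive B)) ⟩
    ∣ ∁ B ∣ + ω G (∁ (∁ B)) + ∣ edgesIn G B ∣    ≡⟨ cong (_+ ∣ edgesIn G B ∣) (sym (c-∁δ G)) ⟩
    c G (edgesIn G B) + ∣ edgesIn G B ∣          ≡⟨ Sparse⇒c+e≡n G basis-sparse ⟩
    n                                           ≡⟨ sym (∣p∣+∣∁p∣≡k B) ⟩
    ∣ B ∣ + ∣ ∁ B ∣                              ≡⟨ +-comm ∣ B ∣ ∣ ∁ B ∣ ⟩
    ∣ ∁ B ∣ + ∣ B ∣                              ∎)
    where
    open ≡-Reasoning
    open BooleanAlgebraProperties (∪-∩-booleanAlgebra n) using (¬-involutive)

lemma4p4 : (G : Graph) → Trivalent G → TwoEdgeConnected G →
    (B : Subset (Graph.n G)) → Basis G B → ω G (∁ B) ≡ ω G B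
lemma4p4 G trivalent 2ec B basis = +-cancelʳ-≡ ∣ edgesIn G B ∣ _ _
  (trans (ω∁B+e≡∣B∣ G trivalent 2ec basis) (sym (ωB+e≡∣B∣ G trivalent 2ec basis)))
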